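{- Every long pyramid is a P-graph.
   Context: All graphs are finite and simple. A pyramid $3PC(b_1b_2b_3,a)$ is a graph made of three chordless paths $P_1=a\dots b_1$, $P_2=a\dots b_2$, $P_3=a\dots b_3$ of length at least 1, two of which have length at least 2, vertex-disjoint except at $a$, such that $b_1b_2b_3$ is a triangle and there are no edges between the paths except those of the triangle and the three edges incident to $a$. A pyramid is long if all three of its paths have length greater than 1. A graph is chordless if no cycle of it has a chord; $L(R)$ is the line graph of $R$. Skeletons: in a graph $R$, a branch vertex is a vertex of degree at least 3; an edge is pendant if at least one endnode has degree 1. A branch is a path of length at least 1 whose internal vertices have degree 2 in $R$ and whose two endnodes are branch vertices; a limb is a path of length at least 1 whose internal vertices have degree 2 in $R$, with one endnode of degree at least 3 and the other of degree 1. Two distinct branches are parallel if they have the same endnodes; two distinct limbs are parallel if they share their endnode of degree at least 3. An attaching vertex is a cut vertex of degree at least 3. For an attaching vertex $x$, let $C_1,\dots,C_t$ be the components of $R-x$ that together with $x$ do not form limbs of $R$; the $x$-petals of $R$ are the graphs $R[V(C_i)\cup\{x\}]$ and, if $x$ is the end of at least two parallel limbs, also the subgraph formed by all limbs of $R$ with endnode $x$. For an integer $k\ge 1$, a $k$-skeleton is a graph $R$ such that: (i) $R$ is connected, triangle-free, chordless and has at least three pendant edges; (ii) $R$ has no parallel branches; (iii) for every cut vertex $u$, every component of $R-u$ has a vertex of degree 1 in $R$; (iv) for every vertex cutset $S=\{a,b\}$ and every component $C$ of $R\setminus S$, either $R[C\cup S]$ is a chordless path from $a$ to $b$ or $C$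 contains a vertex of degree 1 in $R$; (v) for every edge of a cycle of $R$, at least one endnode has degree 2; (vi) each pendant edge gets one label from $\{1,\dots,k\}$; (vii) every label is used at least once and some label is used at least twice; (viii) if a pendant edge with an endnode of degree at least 3 gets label $i$, then no other pendant edge gets label $i$; (ix) if $R$ has no branches then $k=1$, and otherwise, whenever two limbs are parallel, their pendant edges get different labels and at least one of these labels is used more than once; (x) if $k>1$, then for every attaching vertex $x$ and every $x$-petal $H$, at least two distinct labels are used on pendant edges of $H$, and if $\overline H$ is a union of at least one but not all $x$-petals, some label $i$ is used on pendant edges of both $\overline H$ and $(R\setminus\overline H)\cup\{x\}$; (xi) if $k=2$ then both labels are used at least twice. A P-graph is a graph $B$ obtained by taking $k\ge1$ and a $k$-skeleton $R$, forming $L(R)$ where each vertex corresponding to a pendant edge of $R$ (a pendant vertex) gets the label of that edge, adding a clique $K=\{v_1,\dots,v_k\}$ disjoint from $L(R)$, and joining $v_i$ to all pendant vertices of label $i$, for $i=1,\dots,k$. -}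

module Defs where

open import Data.Bool using (Bool; true; false; if_then_else_; T)
open import Data.Nat using (ℕ; zero; suc; _+_; _≤_; _<_)
open import Data.Fin using (Fin; zero; suc; toℕ; fromℕ; inject₁)
import Data.Fin as F
open import Data.Fin.Subset using (Subset; _∈_)
open import Data.List using (List; map; allFin)
open import Data.Nat.ListAction using (sum)
open import Data.Product using (Σ; ∃; ∃-syntax; _×_; _,_; proj₁; proj₂)
open import Data.Sum using (_⊎_; inj₁; inj₂)
open import Data.Unit using (⊤)
open import Data.Empty using (⊥)
open import Relation.Nullary using (¬_)
open import Relation.Binary.PropositionalEquality using (_≡_; _≢_)
open import Function.Bundles using (_↔_; Inverse)

Iff : Set → Set → Set
Iff A B = (A → B) × (B → A)

record Graph (n : ℕ) : Set where
  field
    adj    : Fin n → Fin n → Bool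
    sym    : ∀ u v → adj u v ≡ adj v u
    irrefl : ∀ v → adj v v ≡ false

open Graph public

module _ {n : ℕ} (G : Graph n) where

  Adj : Fin n → Fin n → Set
  Adj u v = T (adj G u v)

  deg : Fin n → ℕ
  deg v = sum (map (λ u → if adj G v u then 1 else 0) (allFin n))

  record Path (ℓ : ℕ) : Set where
    field
      vtx  : Fin (suc ℓ) → Fin n
      inj  : ∀ i j → vtx i ≡ vtx j → i ≡ j
      step : ∀ (i : Fin ℓ) → Adj (vtx (inject₁ i)) (vtx (suc i))

    start : Fin n
    start = vtx zero

    end : Fin n
    end = vtx (fromℕ ℓ)

  open Path public

  OnPath : ∀ {ℓ} → Path ℓ → Fin n → Set
  OnPath P v = ∃[ i ] vtx P i ≡ v

  PathEdge : ∀ {ℓ} → Path ℓ → Fin n → Fin n → Set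
  PathEdge {ℓ} P u v = ∃[ i ]
    ((vtx P (inject₁ i) ≡ u × vtx P (suc i) ≡ v) ⊎
     (vtx P (inject₁ i) ≡ v × vtx P (suc i) ≡ u))

  LastEdge : ∀ {ℓ} → Path ℓ → Fin n → Fin n → Set
  LastEdge {ℓ} P u v = Σ (Fin ℓ) λ i →
    (suc (toℕ i) ≡ ℓ) × (vtx P (inject₁ i) ≡ u) × (vtx P (suc i) ≡ v)

  Consec : ∀ {m} → Fin m → Fin m → Set
  Consec i j = suc (toℕ i) ≡ toℕ j ⊎ suc (toℕ j) ≡ toℕ i

  Internal : ∀ {ℓ} → Fin (suc ℓ) → Set
  Internal {ℓ} i = 0 < toℕ i × toℕ i < ℓ

  ChordlessPath : ∀ {ℓ} → Path ℓ → Set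
  ChordlessPath P = ∀ i j → Adj (vtx P i) (vtx P j) → Consec i j

  SamePath : ∀ {ℓ ℓ'} → Path ℓ → Path ℓ' → Set
  SamePath {ℓ} {ℓ'} P Q =
    ℓ ≡ ℓ' × (∀ i j → toℕ i ≡ toℕ j → vtx P i ≡ vtx Q j)

  RevPath : ∀ {ℓ ℓ'} → Path ℓ → Path ℓ' → Set
  RevPath {ℓ} {ℓ'} P Q =
    ℓ ≡ ℓ' × (∀ i j → toℕ i + toℕ j ≡ ℓ → vtx P i ≡ vtx Q j)

  record Cycle : Set where
    field
      len    : ℕ
      path   : Path len
      long   : 2 ≤ len
      close  : Adj (start path) (end path)

  CycleEdge : Cycle → Fin n → Fin n → Set
  CycleEdge C u v =
    PathEdge (Cycle.path C) u v ⊎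
    ((u ≡ end (Cycle.path C) × v ≡ start (Cycle.path C)) ⊎
     (v ≡ end (Cycle.path C) × u ≡ start (Cycle.path C)))

  CycConsec : (C : Cycle) → Fin (suc (Cycle.len C)) → Fin (suc (Cycle.len C)) → Set
  CycConsec C i j = Consec i j ⊎
    ((toℕ i ≡ 0 × toℕ j ≡ Cycle.len C) ⊎ (toℕ j ≡ 0 × toℕ i ≡ Cycle.len C))

  ChordlessGraph : Set
  ChordlessGraph = ∀ (C : Cycle) i j →
    Adj (vtx (Cycle.path C) i) (vtx (Cycle.path C) j) → CycConsec C i j

  TriangleFree : Set
  TriangleFree = ∀ x y z → Adj x y → Adj y z → Adj x z → ⊥

  data Reach (S : Fin n → Set) : Fin n → Fin n → Set where
    r-here : ∀ {x} → S x → Reach S x x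
    r-step : ∀ {x y z} → S x → Adj x y → Reach S y z → Reach S x z

  Connected : Set
  Connected = ∀ u v → Reach (λ _ → ⊤) u v

  record IsComponent (X : Fin n → Set) (C : Subset n) : Set where
    field
      avoid    : ∀ v → v ∈ C → ¬ X v
      nonempty : ∃[ v ] v ∈ C
      conn     : ∀ u v → u ∈ C → v ∈ C → Reach (λ w → ¬ X w) u v
      closed   : ∀ u v → u ∈ C → ¬ X v → Adj u v → v ∈ C

  CutVertex : Fin n → Set
  CutVertex u = ∃[ x ] ∃[ y ] (x ≢ u × y ≢ u × ¬ Reach (λ w → w ≢ u) x y)

  TwoCutset : Fin n → Fin n → Set
  TwoCutset a b = a ≢ b × ∃[ x ] ∃[ y ]
    (x ≢ a × x ≢ b × y ≢ a × y ≢ b × ¬ Reach (λ w → w ≢ a × w ≢ b) x y)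

  Edge : Set
  Edge = Σ (Fin n) λ u → Σ (Fin n) λ v → (u F.< v) × Adj u v

  e₁ : Edge → Fin n
  e₁ e = proj₁ e

  e₂ : Edge → Fin n
  e₂ e = proj₁ (proj₂ e)

  Incident : Edge → Fin n → Set
  Incident e x = x ≡ e₁ e ⊎ x ≡ e₂ e

  EdgeOn : Edge → Fin n → Fin n → Set
  EdgeOn e u v = (e₁ e ≡ u × e₂ e ≡ v) ⊎ (e₁ e ≡ v × e₂ e ≡ u)

  EdgeIn : (Fin n → Set) → Edge → Set
  EdgeIn W e = W (e₁ e) × W (e₂ e)

  Pendant : Edge → Set
  Pendant e = deg (e₁ e) ≡ 1 ⊎ deg (e₂ e) ≡ 1

  record IsBranch {ℓ} (P : Path ℓ) : Set where
    field
      nontriv  : 1 ≤ ℓ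
      startDeg : 3 ≤ deg (start P)
      endDeg   : 3 ≤ deg (end P)
      inner    : ∀ i → Internal i → deg (vtx P i) ≡ 2

  record IsLimb {ℓ} (P : Path ℓ) : Set where
    field
      nontriv  : 1 ≤ ℓ
      startDeg : 3 ≤ deg (start P)
      endDeg   : deg (end P) ≡ 1
      inner    : ∀ i → Internal i → deg (vtx P i) ≡ 2

  HasBranch : Set
  HasBranch = Σ ℕ λ ℓ → Σ (Path ℓ) IsBranch

  NoParallelBranches : Set
  NoParallelBranches = ∀ {ℓ ℓ'} (P : Path ℓ) (Q : Path ℓ') →
    IsBranch P → IsBranch Q →
    ((start P ≡ start Q × end P ≡ end Q) ⊎ (start P ≡ end Q × end P ≡ start Q)) →
    SamePath P Q ⊎ RevPath P Q

  ParallelLimbs : ∀ {ℓ ℓ'} → Path ℓ → Path ℓ' → Set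
  ParallelLimbs L₁ L₂ =
    IsLimb L₁ × IsLimb L₂ × start L₁ ≡ start L₂ × ¬ SamePath L₁ L₂

  Attaching : Fin n → Set
  Attaching x = CutVertex x × 3 ≤ deg x

  FormsLimb : Fin n → Subset n → Set
  FormsLimb x C = Σ ℕ λ ℓ → Σ (Path ℓ) λ L →
    IsLimb L × start L ≡ x × (∀ v → Iff (v ≡ x ⊎ v ∈ C) (OnPath L v))

  TwoParallelLimbsAt : Fin n → Set
  TwoParallelLimbsAt x = Σ ℕ λ ℓ → Σ ℕ λ ℓ' → Σ (Path ℓ) λ L₁ → Σ (Path ℓ') λ L₂ →
    ParallelLimbs L₁ L₂ × start L₁ ≡ x

  -- W is the vertex set of an x-petal (the petal is the induced
  -- subgraph G[W])
  IsPetal : Fin n → Subset n → Set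
  IsPetal x W =
    (Σ (Subset n) λ C → IsComponent (λ w → w ≡ x) C × ¬ FormsLimb x C ×
       (∀ v → Iff (v ∈ W) (v ≡ x ⊎ v ∈ C)))
    ⊎
    (TwoParallelLimbsAt x ×
       (∀ v → Iff (v ∈ W)
                  (Σ ℕ λ ℓ → Σ (Path ℓ) λ L → IsLimb L × start L ≡ x × OnPath L v)))

  module Labels {k : ℕ} (lab : Edge → Fin k) where

    Used : Fin k → Set
    Used i = Σ Edge λ e → Pendant e × lab e ≡ i

    UsedTwice : Fin k → Set
    UsedTwice i = Σ Edge λ e → Σ Edge λ f →
      e ≢ f × Pendant e × Pendant f × lab e ≡ i × lab f ≡ i

    UsedIn : (Fin n → Set) → Fin k → Set
    UsedIn W i = Σ Edge λ e → Pendant e × EdgeIn W e × lab e ≡ i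

    UnionSel : Fin n → (Subset n → Bool) → Fin n → Set
    UnionSel x sel v = Σ (Subset n) λ W → IsPetal x W × sel W ≡ true × v ∈ W

  record IsSkeleton (k : ℕ) (lab : Edge → Fin k) : Set where
    open Labels lab
    field
      connected    : Connected
      triangleFree : TriangleFree
      chordless    : ChordlessGraph
      threePendant : Σ Edge λ a → Σ Edge λ b → Σ Edge λ c →
                     Pendant a × Pendant b × Pendant c ×
                     a ≢ b × a ≢ c × b ≢ c
      noParallel   : NoParallelBranches
      cutCond      : ∀ u → CutVertex u → ∀ C → IsComponent (λ w → w ≡ u) C →
                     ∃[ v ] (v ∈ C × deg v ≡ 1)
      twoCutCond   : ∀ a b → TwoCutset a b → ∀ C →
                     IsComponent (λ w → w ≡ a ⊎ w ≡ b) C →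
                     (Σ ℕ λ ℓ → Σ (Path ℓ) λ P → ChordlessPath P ×
                        start P ≡ a × end P ≡ b ×
                        (∀ v → Iff (v ∈ C ⊎ (v ≡ a ⊎ v ≡ b)) (OnPath P v)))
                     ⊎ (∃[ v ] (v ∈ C × deg v ≡ 1))
      cycleCond    : ∀ (C : Cycle) u v → CycleEdge C u v → deg u ≡ 2 ⊎ deg v ≡ 2
      -- (vi) is the labelling lab itself; k ≥ 1
      kPos         : 1 ≤ k
      allUsed      : ∀ i → Used i
      someTwice    : ∃[ i ] UsedTwice i
      uniqueBig    : ∀ e → Pendant e → (3 ≤ deg (e₁ e) ⊎ 3 ≤ deg (e₂ e)) →
                     ∀ f → Pendant f → f ≢ e → lab f ≢ lab e
      noBranch     : ¬ HasBranch → k ≡ 1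
      parLimbs     : HasBranch → ∀ {ℓ ℓ'} (L₁ : Path ℓ) (L₂ : Path ℓ') →
                     ParallelLimbs L₁ L₂ → ∀ f₁ f₂ →
                     (Σ (Fin n) λ u → LastEdge L₁ u (end L₁) × EdgeOn f₁ u (end L₁)) →
                     (Σ (Fin n) λ u → LastEdge L₂ u (end L₂) × EdgeOn f₂ u (end L₂)) →
                     lab f₁ ≢ lab f₂ × (UsedTwice (lab f₁) ⊎ UsedTwice (lab f₂))
      petalCond    : 1 < k → ∀ x → Attaching x →
                     (∀ W → IsPetal x W →
                        Σ (Fin k) λ i → Σ (Fin k) λ j →
                          i ≢ j × UsedIn (_∈ W) i × UsedIn (_∈ W) j)
                     ×
                     (∀ (sel : Subset n → Bool) →
                        (Σ (Subset n) λ W → IsPetal x W × sel W ≡ true) →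
                        (Σ (Subset n) λ W → IsPetal x W × sel W ≡ false) →
                        Σ (Fin k) λ i →
                          UsedIn (UnionSel x sel) i ×
                          UsedIn (λ v → ¬ UnionSel x sel v ⊎ v ≡ x) i)
      kTwo         : k ≡ 2 → ∀ i → UsedTwice i

-- adjacency of the graph built from L(R) and the clique K = {v₁,…,vₖ}
PAdj : ∀ {m k} (R : Graph m) → (Edge R → Fin k) →
       Edge R ⊎ Fin k → Edge R ⊎ Fin k → Set
PAdj R lab (inj₁ e) (inj₁ f) = e ≢ f × ∃[ x ] (Incident R e x × Incident R f x)
PAdj R lab (inj₁ e) (inj₂ i) = Pendant R e × lab e ≡ i
PAdj R lab (inj₂ i) (inj₁ e) = Pendant R e × lab e ≡ i
PAdj R lab (inj₂ i) (inj₂ j) = i ≢ j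

IsPGraph : ∀ {n} → Graph n → Set
IsPGraph {n} B =
  Σ ℕ λ k → Σ ℕ λ m → Σ (Graph m) λ R → Σ (Edge R → Fin k) λ lab →
    IsSkeleton R k lab ×
    Σ (Fin n ↔ (Edge R ⊎ Fin k)) λ φ →
      ∀ u v → Iff (Adj B u v) (PAdj R lab (Inverse.to φ u) (Inverse.to φ v))

record LongPyramid {n : ℕ} (B : Graph n) : Set where
  field
    a        : Fin n
    len      : Fin 3 → ℕ
    long     : ∀ t → 2 ≤ len t
    P        : (t : Fin 3) → Path B (len t)
    fromA    : ∀ t → start (P t) ≡ a
    disjoint : ∀ s t → s ≢ t → ∀ i j →
               vtx (P s) i ≡ vtx (P t) j → vtx (P s) i ≡ a
    cover    : ∀ v → ∃[ t ] OnPath B (P t) v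
    edges    : ∀ u v → Iff (Adj B u v)
                 ((∃[ t ] PathEdge B (P t) u v) ⊎
                  (∃[ s ] ∃[ t ] (s ≢ t × u ≡ end (P s) × v ≡ end (P t))))

module Submission where

-- Let R be the spider on the vertices of B with centre the apex a, whose leg t
-- is the path Pₜ with a removed and bₜ joined to a instead.  Each vertex of Pₜ
-- other than a corresponds to the edge of R leaving it towards a, and a itself
-- to a one-vertex clique joined to the three pendant edges; under this
-- correspondence the edges of B are exactly the pairs of edges of R sharing a
-- vertex, plus the apex-to-pendant pairs.  R is a tree, since every vertex but a
-- has exactly one neighbour closer to a, and a is its only branch vertex, so
-- with k = 1 most skeleton conditions hold vacuously; deleting one or two
-- vertices of R leaves components that either contain a leaf or are the open
-- segment of a leg between the two deleted vertices.

open import Defs hiding (sym)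
open import Data.Bool using (Bool; true; false; if_then_else_; T)
open import Data.Bool.Properties using (T-irrelevant)
open import Data.Empty using (⊥; ⊥-elim)
open import Data.Fin using (Fin; zero; suc; toℕ; fromℕ; fromℕ<; inject₁)
open import Data.Fin.Properties
  using (toℕ-fromℕ; toℕ-fromℕ<; fromℕ<-toℕ; toℕ-inject₁; toℕ<n; toℕ≤pred[n]; toℕ-injective; any?)
  renaming (_≟_ to _≟ᶠ_; <-cmp to <-cmpᶠ; <-irrelevant to <ᶠ-irrelevant; <-asym to <ᶠ-asym)
open import Data.Fin.Subset using (Subset; _∈_)
open import Data.List using (List; []; _∷_; length; filter; map; allFin; upTo)
import Data.List.Extrema.Nat as Extrema
import Data.List.Membership.Propositional as List
open import Data.List.Membership.Propositional.Properties using (∈-filter⁺; ∈-filter⁻; ∈-allFin; ∈-upTo⁺; ∈-upTo⁻)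
open import Data.List.Membership.Propositional.Properties.WithK using (unique∧set⇒bag)
open import Data.List.Relation.Binary.BagAndSetEquality using (∼bag⇒↭)
open import Data.List.Relation.Binary.Permutation.Propositional.Properties using (↭-length)
open import Data.List.Relation.Unary.All as All using (All; []; _∷_)
open import Data.List.Relation.Unary.Any using (here; there)
open import Data.List.Relation.Unary.AllPairs using ([]; _∷_)
open import Data.List.Relation.Unary.Unique.Propositional using (Unique)
import Data.List.Relation.Unary.Unique.Propositional.Properties as Unique
open import Data.Nat using (ℕ; zero; suc; _+_; _∸_; _≤_; _<_; z≤n; s≤s; _≤?_)
open import Data.Nat.ListAction using (sum)
open import Data.Nat.Properties
open import Data.Product using (Σ; ∃-syntax; _×_; _,_; proj₁; proj₂)
open import Data.Sum using (_⊎_; inj₁; inj₂; [_,_]′; map₂; swap)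
open import Data.Unit using (⊤; tt)
open import Function using (id)
open import Function.Bundles using (_↔_; Inverse; mk↔ₛ′; mk⇔)
open import Relation.Binary using (tri<; tri≈; tri>)
open import Relation.Binary.PropositionalEquality
open import Relation.Nullary using (¬_; Dec; yes; no; does)
open import Relation.Nullary.Decidable using (T?; _×-dec_; _⊎-dec_; dec-false)

does-≡ : ∀ {P Q : Set} → (P → Q) → (Q → P) → (p : Dec P) (q : Dec Q) → does p ≡ does q
does-≡ f g (yes p) (yes q) = refl
does-≡ f g (yes p) (no ¬q) = ⊥-elim (¬q (f p))
does-≡ f g (no ¬p) (yes q) = ⊥-elim (¬p (g q))
does-≡ f g (no ¬p) (no ¬q) = refl

T-does⁻ : ∀ {P : Set} (p : Dec P) → T (does p) → P
T-does⁻ (yes p) _ = p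

T-does⁺ : ∀ {P : Set} (p : Dec P) → P → T (does p)
T-does⁺ (yes _) _ = tt
T-does⁺ (no ¬p) p = ¬p p

sum-indicator≡length-filter : ∀ {A : Set} (p : A → Bool) xs →
  sum (map (λ x → if p x then 1 else 0) xs) ≡ length (filter (λ x → T? (p x)) xs)
sum-indicator≡length-filter p [] = refl
sum-indicator≡length-filter p (x ∷ xs) with p x
... | true  = cong suc (sum-indicator≡length-filter p xs)
... | false = sum-indicator≡length-filter p xs

argmax-upTo : (f : ℕ → ℕ) (ℓ : ℕ) → Σ ℕ λ m → m ≤ ℓ × (∀ x → x ≤ ℓ → f x ≤ f m)
argmax-upTo f ℓ = m , m≤ℓ , λ x x≤ℓ → All.lookup (Extrema.f[xs]≤f[argmax] {f = f} 0 xs) (∈-upTo⁺ (s≤s x≤ℓ))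
  where
  xs = upTo (suc ℓ)
  m = Extrema.argmax f 0 xs
  m≤ℓ : m ≤ ℓ
  m≤ℓ = Extrema.argmax-all f {P = _≤ ℓ} z≤n (All.tabulate λ x∈ → ≤-pred (∈-upTo⁻ x∈))

module _ {m : ℕ} (G : Graph m) where

  adj-sym : ∀ {u v} → Adj G u v → Adj G v u
  adj-sym {u} {v} = subst T (Graph.sym G u v)

  adj-irrefl : ∀ {v} → ¬ Adj G v v
  adj-irrefl {v} = subst T (irrefl G v)

  adj⇒≢ : ∀ {u v} → Adj G u v → u ≢ v
  adj⇒≢ uv refl = adj-irrefl uv

  deg≡length : ∀ {w} (xs : List (Fin m)) → Unique xs →
               (∀ {u} → Adj G w u → u List.∈ xs) → All (Adj G w) xs → deg G w ≡ length xs
  deg≡length {w} xs xs! nbr⊆xs xs⊆nbr =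
    trans (sum-indicator≡length-filter (adj G w) (allFin m))
          (↭-length (∼bag⇒↭ (unique∧set⇒bag (Unique.filter⁺ adj? (Unique.allFin⁺ m)) xs! (mk⇔ to from))))
    where
    adj? = λ u → T? (adj G w u)
    to : ∀ {u} → u List.∈ filter adj? (allFin m) → u List.∈ xs
    to u∈ = nbr⊆xs (proj₂ (∈-filter⁻ adj? {xs = allFin m} u∈))
    from : ∀ {u} → u List.∈ xs → u List.∈ filter adj? (allFin m)
    from u∈ = ∈-filter⁺ adj? (∈-allFin _) (All.lookup xs⊆nbr u∈)

  reach-head : ∀ {S x y} → Reach G S x y → S x
  reach-head (r-here s) = s
  reach-head (r-step s _ _) = s

  reach-trans : ∀ {S x y z} → Reach G S x y → Reach G S y z → Reach G S x z
  reach-trans (r-here _) r′ = r′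
  reach-trans (r-step s xy r) r′ = r-step s xy (reach-trans r r′)

  reach-sym : ∀ {S x y} → Reach G S x y → Reach G S y x
  reach-sym (r-here s) = r-here s
  reach-sym (r-step s xy r) = reach-trans (reach-sym r) (r-step (reach-head r) (adj-sym xy) (r-here s))

  component-reach : ∀ {X C x y} → IsComponent G X C → x ∈ C → Reach G (λ w → ¬ X w) x y → y ∈ C
  component-reach IC x∈C (r-here _) = x∈C
  component-reach IC x∈C (r-step {x} {y} _ xy r) =
    component-reach IC (IsComponent.closed IC x y x∈C (reach-head r) xy) r

  edge-ext : ∀ (e f : Edge G) → e₁ G e ≡ e₁ G f → e₂ G e ≡ e₂ G f → e ≡ f
  edge-ext (u , v , u<v , uv) (.u , .v , u<v′ , uv′) refl refl
    rewrite <ᶠ-irrelevant u<v u<v′ | T-irrelevant uv uv′ = refl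

  edgeOn-unique : ∀ (e f : Edge G) {x y} → EdgeOn G e x y → EdgeOn G f x y → e ≡ f
  edgeOn-unique e f (inj₁ (p , q)) (inj₁ (p′ , q′)) = edge-ext e f (trans p (sym p′)) (trans q (sym q′))
  edgeOn-unique e f (inj₂ (p , q)) (inj₂ (p′ , q′)) = edge-ext e f (trans p (sym p′)) (trans q (sym q′))
  edgeOn-unique (_ , _ , lt , _) (_ , _ , lt′ , _) (inj₁ (refl , refl)) (inj₂ (refl , refl)) = ⊥-elim (<ᶠ-asym lt lt′)
  edgeOn-unique (_ , _ , lt , _) (_ , _ , lt′ , _) (inj₂ (refl , refl)) (inj₁ (refl , refl)) = ⊥-elim (<ᶠ-asym lt lt′)

  incident-edgeOn : ∀ e {x y w} → EdgeOn G e x y → Incident G e w → w ≡ x ⊎ w ≡ y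
  incident-edgeOn e (inj₁ (refl , refl)) i = i
  incident-edgeOn e (inj₂ (refl , refl)) (inj₁ p) = inj₂ p
  incident-edgeOn e (inj₂ (refl , refl)) (inj₂ p) = inj₁ p

  edgeOn-incident : ∀ e {x y w} → EdgeOn G e x y → w ≡ x ⊎ w ≡ y → Incident G e w
  edgeOn-incident e (inj₁ (refl , refl)) i = i
  edgeOn-incident e (inj₂ (refl , refl)) (inj₁ p) = inj₂ p
  edgeOn-incident e (inj₂ (refl , refl)) (inj₂ p) = inj₁ p

  pendant-edgeOn : ∀ e {x y} → EdgeOn G e x y → Pendant G e → deg G x ≡ 1 ⊎ deg G y ≡ 1
  pendant-edgeOn e (inj₁ (refl , refl)) p = p
  pendant-edgeOn e (inj₂ (refl , refl)) (inj₁ p) = inj₂ p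
  pendant-edgeOn e (inj₂ (refl , refl)) (inj₂ p) = inj₁ p

  edgeOn-pendant : ∀ e {x y} → EdgeOn G e x y → deg G x ≡ 1 ⊎ deg G y ≡ 1 → Pendant G e
  edgeOn-pendant e (inj₁ (refl , refl)) p = p
  edgeOn-pendant e (inj₂ (refl , refl)) (inj₁ p) = inj₂ p
  edgeOn-pendant e (inj₂ (refl , refl)) (inj₂ p) = inj₁ p

  opaque
    edgeBetween : ∀ u v → Adj G u v → Edge G
    edgeBetween u v uv with <-cmpᶠ u v
    ... | tri< lt _ _ = u , v , lt , uv
    ... | tri≈ _ refl _ = ⊥-elim (adj-irrefl uv)
    ... | tri> _ _ gt = v , u , gt , adj-sym uv

    edgeBetween-on : ∀ u v uv → EdgeOn G (edgeBetween u v uv) u v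
    edgeBetween-on u v uv with <-cmpᶠ u v
    ... | tri< _ _ _ = inj₁ (refl , refl)
    ... | tri≈ _ refl _ = ⊥-elim (adj-irrefl uv)
    ... | tri> _ _ _ = inj₂ (refl , refl)

suc[ℓ∸a]≡ℓ∸b⇒suc[b]≡a : ∀ {a b ℓ} → a ≤ ℓ → b ≤ ℓ → suc (ℓ ∸ a) ≡ ℓ ∸ b → suc b ≡ a
suc[ℓ∸a]≡ℓ∸b⇒suc[b]≡a {a} {b} {ℓ} a≤ℓ b≤ℓ e = +-cancelˡ-≡ (ℓ ∸ a) (suc b) a (begin
  ℓ ∸ a + suc b    ≡⟨ +-suc (ℓ ∸ a) b ⟩
  suc (ℓ ∸ a) + b  ≡⟨ cong (_+ b) e ⟩
  ℓ ∸ b + b        ≡⟨ m∸n+n≡m b≤ℓ ⟩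
  ℓ                ≡⟨ m∸n+n≡m a≤ℓ ⟨
  ℓ ∸ a + a        ∎)
  where open ≡-Reasoning

module _ {m : ℕ} (G : Graph m) where

  -- Values of at beyond ℓ are junk.
  record ChordlessSeq (ℓ : ℕ) : Set where
    field
      at           : ℕ → Fin m
      at-injective : ∀ i j → i ≤ ℓ → j ≤ ℓ → at i ≡ at j → i ≡ j
      at-step      : ∀ i → i < ℓ → Adj G (at i) (at (suc i))
      at-chordless : ∀ i j → i ≤ ℓ → j ≤ ℓ → Adj G (at i) (at j) → suc i ≡ j ⊎ suc j ≡ i

  open ChordlessSeq

  toPath : ∀ {ℓ} → ChordlessSeq ℓ → Path G ℓ
  toPath S = record
    { vtx  = λ i → at S (toℕ i)
    ; inj  = λ i j e → toℕ-injective (at-injective S (toℕ i) (toℕ j) (toℕ≤pred[n] i) (toℕ≤pred[n] j) e)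
    ; step = λ i → subst (λ z → Adj G (at S z) (at S (suc (toℕ i)))) (sym (toℕ-inject₁ i))
                         (at-step S (toℕ i) (toℕ<n i)) }

  toPath-chordless : ∀ {ℓ} (S : ChordlessSeq ℓ) → ChordlessPath G (toPath S)
  toPath-chordless S i j = at-chordless S (toℕ i) (toℕ j) (toℕ≤pred[n] i) (toℕ≤pred[n] j)

  toPath-end : ∀ {ℓ} (S : ChordlessSeq ℓ) → end (toPath S) ≡ at S ℓ
  toPath-end {ℓ} S = cong (at S) (toℕ-fromℕ ℓ)

  onPath-toPath⁻ : ∀ {ℓ} (S : ChordlessSeq ℓ) {v} → OnPath G (toPath S) v → Σ ℕ λ i → i ≤ ℓ × at S i ≡ v
  onPath-toPath⁻ S (i , e) = toℕ i , toℕ≤pred[n] i , e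

  onPath-toPath⁺ : ∀ {ℓ} (S : ChordlessSeq ℓ) {v} i → i ≤ ℓ → at S i ≡ v → OnPath G (toPath S) v
  onPath-toPath⁺ S i i≤ℓ e = fromℕ< (s≤s i≤ℓ) , trans (cong (at S) (toℕ-fromℕ< (s≤s i≤ℓ))) e

  reverse : ∀ {ℓ} → ChordlessSeq ℓ → ChordlessSeq ℓ
  reverse {ℓ} S = record
    { at           = λ i → at S (ℓ ∸ i)
    ; at-injective = λ i j i≤ℓ j≤ℓ e → ∸-cancelˡ-≡ i≤ℓ j≤ℓ (at-injective S _ _ (m∸n≤m ℓ i) (m∸n≤m ℓ j) e)
    ; at-step      = λ i i<ℓ → subst (λ z → Adj G (at S z) (at S (ℓ ∸ suc i))) (sym (+-∸-assoc 1 i<ℓ))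
                                 (adj-sym G (at-step S (ℓ ∸ suc i) (∸-monoʳ-< {o = 0} (s≤s z≤n) i<ℓ)))
    ; at-chordless = λ i j i≤ℓ j≤ℓ ij → flip i≤ℓ j≤ℓ (at-chordless S _ _ (m∸n≤m ℓ i) (m∸n≤m ℓ j) ij) }
    where
    flip : ∀ {i j} → i ≤ ℓ → j ≤ ℓ →
           suc (ℓ ∸ i) ≡ ℓ ∸ j ⊎ suc (ℓ ∸ j) ≡ ℓ ∸ i → suc i ≡ j ⊎ suc j ≡ i
    flip i≤ℓ j≤ℓ (inj₁ e) = inj₂ (suc[ℓ∸a]≡ℓ∸b⇒suc[b]≡a i≤ℓ j≤ℓ e)
    flip i≤ℓ j≤ℓ (inj₂ e) = inj₁ (suc[ℓ∸a]≡ℓ∸b⇒suc[b]≡a j≤ℓ i≤ℓ e)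

  onPath-reverse : ∀ {ℓ} (S : ChordlessSeq ℓ) {v} → OnPath G (toPath (reverse S)) v → OnPath G (toPath S) v
  onPath-reverse {ℓ} S p with onPath-toPath⁻ (reverse S) p
  ... | i , _ , e = onPath-toPath⁺ S (ℓ ∸ i) (m∸n≤m ℓ i) e

  onPath-unreverse : ∀ {ℓ} (S : ChordlessSeq ℓ) {v} → OnPath G (toPath S) v → OnPath G (toPath (reverse S)) v
  onPath-unreverse {ℓ} S p with onPath-toPath⁻ S p
  ... | i , i≤ℓ , e = onPath-toPath⁺ (reverse S) (ℓ ∸ i) (m∸n≤m ℓ i) (trans (cong (at S) (m∸[m∸n]≡n i≤ℓ)) e)

  opaque
    cycleAt : Cycle G → ℕ → Fin m
    cycleAt C i with i ≤? Cycle.len C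
    ... | yes i≤ℓ = vtx (Cycle.path C) (fromℕ< (s≤s i≤ℓ))
    ... | no _ = start (Cycle.path C)

    cycleAt-vtx : ∀ C (i : Fin (suc (Cycle.len C))) → cycleAt C (toℕ i) ≡ vtx (Cycle.path C) i
    cycleAt-vtx C i with toℕ i ≤? Cycle.len C
    ... | yes i≤ℓ = cong (vtx (Cycle.path C)) (fromℕ<-toℕ i (s≤s i≤ℓ))
    ... | no i≰ℓ = ⊥-elim (i≰ℓ (toℕ≤pred[n] i))

  module _ (C : Cycle G) where
    private
      ℓ : ℕ
      ℓ = Cycle.len C
      Q : Path G ℓ
      Q = Cycle.path C
      at′ : ℕ → Fin m
      at′ = cycleAt C

    cycleAt-fromℕ< : ∀ {i} (i≤ℓ : i ≤ ℓ) → at′ i ≡ vtx Q (fromℕ< (s≤s i≤ℓ))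
    cycleAt-fromℕ< i≤ℓ = trans (cong at′ (sym (toℕ-fromℕ< (s≤s i≤ℓ)))) (cycleAt-vtx C _)

    cycleAt-injective : ∀ i j → i ≤ ℓ → j ≤ ℓ → at′ i ≡ at′ j → i ≡ j
    cycleAt-injective i j i≤ℓ j≤ℓ e = begin
      i                             ≡⟨ toℕ-fromℕ< (s≤s i≤ℓ) ⟨
      toℕ (fromℕ< (s≤s i≤ℓ))       ≡⟨ cong toℕ (inj Q _ _ vtx-eq) ⟩
      toℕ (fromℕ< (s≤s j≤ℓ))       ≡⟨ toℕ-fromℕ< (s≤s j≤ℓ) ⟩
      j                             ∎
      where
      open ≡-Reasoning
      vtx-eq = trans (sym (cycleAt-fromℕ< i≤ℓ)) (trans e (cycleAt-fromℕ< j≤ℓ))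

    cycleAt-step : ∀ i → i < ℓ → Adj G (at′ i) (at′ (suc i))
    cycleAt-step i i<ℓ = subst₂ (Adj G)
      (trans (sym (cycleAt-vtx C (inject₁ k))) (cong at′ (trans (toℕ-inject₁ k) ek)))
      (trans (sym (cycleAt-vtx C (suc k))) (cong (λ z → at′ (suc z)) ek))
      (step Q k)
      where
      k = fromℕ< i<ℓ
      ek = toℕ-fromℕ< i<ℓ

    cycleAt-close : Adj G (at′ ℓ) (at′ 0)
    cycleAt-close = adj-sym G (subst₂ (Adj G) (sym (cycleAt-vtx C zero))
      (trans (sym (cycleAt-vtx C (fromℕ ℓ))) (cong at′ (toℕ-fromℕ ℓ))) (Cycle.close C))

    cycleAt-two-neighbours : ∀ i → i ≤ ℓ →
      Σ ℕ λ j → Σ ℕ λ j′ → j ≤ ℓ × j′ ≤ ℓ × j ≢ j′ × Adj G (at′ i) (at′ j) × Adj G (at′ i) (at′ j′)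
    cycleAt-two-neighbours zero _ =
      ℓ , 1 , ≤-refl , 1≤ℓ , (λ e → <⇒≢ 2≤ℓ (sym e)) , adj-sym G cycleAt-close , cycleAt-step 0 1≤ℓ
      where
      2≤ℓ = Cycle.long C
      1≤ℓ = ≤-trans (s≤s z≤n) 2≤ℓ
    cycleAt-two-neighbours (suc i) i<ℓ with m≤n⇒m<n∨m≡n i<ℓ
    ... | inj₁ i+1<ℓ =
      i , suc (suc i) , <⇒≤ i<ℓ , i+1<ℓ , <⇒≢ (m<n⇒m<1+n (n<1+n i)) ,
      adj-sym G (cycleAt-step i i<ℓ) , cycleAt-step (suc i) i+1<ℓ
    ... | inj₂ refl =
      i , 0 , <⇒≤ i<ℓ , z≤n , i≢0 , adj-sym G (cycleAt-step i i<ℓ) , cycleAt-close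
      where
      i≢0 : i ≢ 0
      i≢0 refl = <⇒≢ (Cycle.long C) refl

-- If the height h changes by one along every edge and no vertex has two lower
-- neighbours, the highest vertex of a triangle or cycle gives a contradiction.
module Graded {m : ℕ} (G : Graph m) (h : Fin m → ℕ)
  (h-step : ∀ {u v} → Adj G u v → h u ≡ suc (h v) ⊎ h v ≡ suc (h u))
  (lower-unique : ∀ {w u v} → Adj G w u → Adj G w v → h u < h w → h v < h w → u ≡ v) where

  lower-neighbour-unique : ∀ {w u v} → Adj G w u → Adj G w v → h u ≤ h w → h v ≤ h w → u ≡ v
  lower-neighbour-unique wu wv u≤w v≤w = lower-unique wu wv (strict wu u≤w) (strict wv v≤w)
    where
    strict : ∀ {w u} → Adj G w u → h u ≤ h w → h u < h w
    strict wu u≤w with h-step wu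
    ... | inj₁ e = subst (h _ <_) (sym e) ≤-refl
    ... | inj₂ e = ⊥-elim (<⇒≱ (subst (h _ <_) (sym e) ≤-refl) u≤w)

  triangleFree : TriangleFree G
  triangleFree x y z xy yz xz with ≤-total (h x) (h y)
  ... | inj₁ x≤y with ≤-total (h z) (h y)
  ...   | inj₁ z≤y = adj⇒≢ G xz (lower-neighbour-unique (adj-sym G xy) yz x≤y z≤y)
  ...   | inj₂ y≤z = adj⇒≢ G xy (lower-neighbour-unique (adj-sym G xz) (adj-sym G yz) (≤-trans x≤y y≤z) y≤z)
  triangleFree x y z xy yz xz | inj₂ y≤x with ≤-total (h z) (h x)
  ...   | inj₁ z≤x = adj⇒≢ G yz (lower-neighbour-unique xy xz y≤x z≤x)
  ...   | inj₂ x≤z = adj⇒≢ G xy (lower-neighbour-unique (adj-sym G xz) (adj-sym G yz) x≤z (≤-trans y≤x x≤z))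

  acyclic : Cycle G → ⊥
  acyclic C with argmax-upTo (λ i → h (cycleAt G C i)) (Cycle.len C)
  ... | i , i≤ℓ , top with cycleAt-two-neighbours G C i i≤ℓ
  ... | j , j′ , j≤ℓ , j′≤ℓ , j≢j′ , ij , ij′ =
    j≢j′ (cycleAt-injective G C j j′ j≤ℓ j′≤ℓ (lower-neighbour-unique ij ij′ (top j j≤ℓ) (top j′ j′≤ℓ)))

module PyramidSkeleton {n : ℕ} (B : Graph n) (LP : LongPyramid B) where
  open LongPyramid LP

  OnLeg : Fin 3 → ℕ → Set
  OnLeg t i = 1 ≤ i × i ≤ len t

  -- Indices past the end of a leg read as the apex a.
  opaque
    leg : Fin 3 → ℕ → Fin n
    leg t i with i ≤? len t
    ... | yes i≤ = vtx (P t) (fromℕ< (s≤s i≤))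
    ... | no _ = a

    leg-fromℕ< : ∀ t i (i≤ : i ≤ len t) → leg t i ≡ vtx (P t) (fromℕ< (s≤s i≤))
    leg-fromℕ< t i i≤ with i ≤? len t
    ... | yes i≤′ = cong (λ z → vtx (P t) (fromℕ< (s≤s z))) (≤-irrelevant i≤′ i≤)
    ... | no i≰ = ⊥-elim (i≰ i≤)

    leg-past : ∀ t i → len t < i → leg t i ≡ a
    leg-past t i len<i with i ≤? len t
    ... | yes i≤ = ⊥-elim (<⇒≱ len<i i≤)
    ... | no _ = refl

  leg-vtx : ∀ t (i : Fin (suc (len t))) → vtx (P t) i ≡ leg t (toℕ i)
  leg-vtx t i = trans (cong (vtx (P t)) (sym (fromℕ<-toℕ i _))) (sym (leg-fromℕ< t (toℕ i) (toℕ≤pred[n] i)))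

  leg-zero : ∀ t → leg t 0 ≡ a
  leg-zero t = trans (leg-fromℕ< t 0 z≤n) (fromA t)

  leg-top : ∀ t → leg t (suc (len t)) ≡ a
  leg-top t = leg-past t (suc (len t)) ≤-refl

  leg-end : ∀ t → end (P t) ≡ leg t (len t)
  leg-end t = trans (leg-vtx t (fromℕ (len t))) (cong (leg t) (toℕ-fromℕ (len t)))

  len≥1 : ∀ t → 1 ≤ len t
  len≥1 t = ≤-trans (s≤s z≤n) (long t)

  onLeg-1 : ∀ t → OnLeg t 1
  onLeg-1 t = s≤s z≤n , len≥1 t

  onLeg-2 : ∀ t → OnLeg t 2
  onLeg-2 t = s≤s z≤n , long t

  onLeg-top : ∀ t → OnLeg t (len t)
  onLeg-top t = len≥1 t , ≤-refl

  next-onLeg-or-top : ∀ t {i} → i ≤ len t → suc i ≤ len t ⊎ i ≡ len t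
  next-onLeg-or-top t {i} i≤ with suc i ≤? len t
  ... | yes i<len = inj₁ i<len
  ... | no i≮len = inj₂ (≤-antisym i≤ (≤-pred (≰⇒> i≮len)))

  vtx-fromℕ<≢a : ∀ t i (i≤ : i ≤ len t) → 1 ≤ i → vtx (P t) (fromℕ< (s≤s i≤)) ≢ a
  vtx-fromℕ<≢a t i i≤ 1≤i e = <⇒≢ 1≤i (sym (begin
    i                           ≡⟨ toℕ-fromℕ< (s≤s i≤) ⟨
    toℕ (fromℕ< (s≤s i≤))      ≡⟨ cong toℕ (inj (P t) _ zero (trans e (sym (fromA t)))) ⟩
    0                           ∎))
    where open ≡-Reasoning

  leg≢apex : ∀ t i → OnLeg t i → leg t i ≢ a
  leg≢apex t i (1≤i , i≤) e = vtx-fromℕ<≢a t i i≤ 1≤i (trans (sym (leg-fromℕ< t i i≤)) e)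

  leg-injective : ∀ s t i j → OnLeg s i → OnLeg t j → leg s i ≡ leg t j → s ≡ t × i ≡ j
  leg-injective s t i j (1≤i , i≤) (1≤j , j≤) e with s ≟ᶠ t
  ... | no s≢t = ⊥-elim (vtx-fromℕ<≢a s i i≤ 1≤i (disjoint s t s≢t _ _ vtx-eq))
    where vtx-eq = trans (sym (leg-fromℕ< s i i≤)) (trans e (leg-fromℕ< t j j≤))
  ... | yes refl =
    refl , trans (sym (toℕ-fromℕ< (s≤s i≤))) (trans (cong toℕ (inj (P s) _ _ vtx-eq)) (toℕ-fromℕ< (s≤s j≤)))
    where vtx-eq = trans (sym (leg-fromℕ< s i i≤)) (trans e (leg-fromℕ< s j j≤))

  legs-disjoint : ∀ s t i j → s ≢ t → OnLeg s i → OnLeg t j → leg s i ≢ leg t j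
  legs-disjoint s t i j s≢t I J e = s≢t (proj₁ (leg-injective s t i j I J e))

  -- Injectivity on 1 … len t + 1, the leg closed up by the apex.
  leg-cancel : ∀ t i j → 1 ≤ i → i ≤ suc (len t) → 1 ≤ j → j ≤ suc (len t) → leg t i ≡ leg t j → i ≡ j
  leg-cancel t i j 1≤i i≤ 1≤j j≤ e with m≤n⇒m<n∨m≡n i≤ | m≤n⇒m<n∨m≡n j≤
  ... | inj₁ i<  | inj₁ j<  = proj₂ (leg-injective t t i j (1≤i , ≤-pred i<) (1≤j , ≤-pred j<) e)
  ... | inj₁ i<  | inj₂ refl = ⊥-elim (leg≢apex t i (1≤i , ≤-pred i<) (trans e (leg-top t)))
  ... | inj₂ refl | inj₁ j< = ⊥-elim (leg≢apex t j (1≤j , ≤-pred j<) (trans (sym e) (leg-top t)))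
  ... | inj₂ refl | inj₂ refl = refl

  Position : Fin n → Set
  Position w = w ≡ a ⊎ Σ (Fin 3) λ t → Σ ℕ λ i → OnLeg t i × leg t i ≡ w

  position : ∀ w → Position w
  position w with cover w
  ... | t , zero , e = inj₁ (trans (sym e) (fromA t))
  ... | t , suc i , e =
    inj₂ (t , toℕ (suc i) , (s≤s z≤n , toℕ≤pred[n] (suc i)) , trans (sym (leg-vtx t (suc i))) e)

  -- Leg t of R is leg t 1, …, leg t (len t), leg t (len t + 1) = a; the vertex
  -- leg t i of B is its edge leg t i — leg t (i + 1).
  LegEdge : Fin 3 → ℕ → Fin n → Fin n → Set
  LegEdge t i u v = (u ≡ leg t i × v ≡ leg t (suc i)) ⊎ (v ≡ leg t i × u ≡ leg t (suc i))

  SpiderAdj : Fin n → Fin n → Set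
  SpiderAdj u v = Σ (Fin 3) λ t → Σ ℕ λ i → OnLeg t i × LegEdge t i u v

  private
    SpiderAdjᶠ : Fin n → Fin n → Set
    SpiderAdjᶠ u v = Σ (Fin 3) λ t → Σ (Fin (len t)) λ k → LegEdge t (suc (toℕ k)) u v

    legEdge? : ∀ t i u v → Dec (LegEdge t i u v)
    legEdge? t i u v = ((u ≟ᶠ leg t i) ×-dec (v ≟ᶠ leg t (suc i))) ⊎-dec ((v ≟ᶠ leg t i) ×-dec (u ≟ᶠ leg t (suc i)))

    spiderAdjᶠ? : ∀ u v → Dec (SpiderAdjᶠ u v)
    spiderAdjᶠ? u v = any? λ t → any? λ k → legEdge? t (suc (toℕ k)) u v

    fromᶠ : ∀ {u v} → SpiderAdjᶠ u v → SpiderAdj u v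
    fromᶠ (t , k , e) = t , suc (toℕ k) , (s≤s z≤n , toℕ<n k) , e

    toᶠ : ∀ {u v} → SpiderAdj u v → SpiderAdjᶠ u v
    toᶠ (t , suc i , (_ , i≤) , e) = t , fromℕ< i≤ , subst (λ z → LegEdge t (suc z) _ _) (sym (toℕ-fromℕ< i≤)) e

  legEdge-sym : ∀ {t i u v} → LegEdge t i u v → LegEdge t i v u
  legEdge-sym (inj₁ (p , q)) = inj₂ (p , q)
  legEdge-sym (inj₂ (p , q)) = inj₁ (p , q)

  spiderAdj-sym : ∀ {u v} → SpiderAdj u v → SpiderAdj v u
  spiderAdj-sym (t , i , I , e) = t , i , I , legEdge-sym e

  leg-next-≢ : ∀ t i → OnLeg t i → leg t i ≢ leg t (suc i)
  leg-next-≢ t i (1≤i , i≤) e = 1+n≢n (sym (leg-cancel t i (suc i) 1≤i (m≤n⇒m≤1+n i≤) (s≤s z≤n) (s≤s i≤) e))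

  spiderAdj-irrefl : ∀ {v} → ¬ SpiderAdj v v
  spiderAdj-irrefl (t , i , I , inj₁ (p , q)) = leg-next-≢ t i I (trans (sym p) q)
  spiderAdj-irrefl (t , i , I , inj₂ (p , q)) = leg-next-≢ t i I (trans (sym p) q)

  opaque
    spiderAdj? : Fin n → Fin n → Bool
    spiderAdj? u v = does (spiderAdjᶠ? u v)

    spiderAdj?-sym : ∀ u v → spiderAdj? u v ≡ spiderAdj? v u
    spiderAdj?-sym u v = does-≡ (λ uv → toᶠ (spiderAdj-sym (fromᶠ uv))) (λ vu → toᶠ (spiderAdj-sym (fromᶠ vu)))
                                (spiderAdjᶠ? u v) (spiderAdjᶠ? v u)

    spiderAdj?-irrefl : ∀ v → spiderAdj? v v ≡ false
    spiderAdj?-irrefl v = dec-false (spiderAdjᶠ? v v) (λ vv → spiderAdj-irrefl (fromᶠ vv))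

    spider-adj⁻ : ∀ {u v} → T (spiderAdj? u v) → SpiderAdj u v
    spider-adj⁻ {u} {v} uv = fromᶠ (T-does⁻ (spiderAdjᶠ? u v) uv)

    spider-adj⁺ : ∀ {u v} → SpiderAdj u v → T (spiderAdj? u v)
    spider-adj⁺ {u} {v} uv = T-does⁺ (spiderAdjᶠ? u v) (toᶠ uv)

  R : Graph n
  R = record { adj = spiderAdj? ; sym = spiderAdj?-sym ; irrefl = spiderAdj?-irrefl }

  toSpider : ∀ {u v} → Adj R u v → SpiderAdj u v
  toSpider = spider-adj⁻

  fromSpider : ∀ {u v} → SpiderAdj u v → Adj R u v
  fromSpider = spider-adj⁺

  leg-step : ∀ t i → OnLeg t i → Adj R (leg t i) (leg t (suc i))
  leg-step t i I = fromSpider (t , i , I , inj₁ (refl , refl))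

  apex-adj-top : ∀ t → Adj R a (leg t (len t))
  apex-adj-top t = adj-sym R (subst (λ z → Adj R (leg t (len t)) z) (leg-top t) (leg-step t (len t) (onLeg-top t)))

  apex-neighbour : ∀ {v} → Adj R a v → Σ (Fin 3) λ t → v ≡ leg t (len t)
  apex-neighbour av with toSpider av
  ... | t , i , I , inj₁ (p , _) = ⊥-elim (leg≢apex t i I (sym p))
  ... | t , i , I , inj₂ (p , q) with next-onLeg-or-top t (proj₂ I)
  ...   | inj₁ i<len = ⊥-elim (leg≢apex t (suc i) (s≤s z≤n , i<len) (sym q))
  ...   | inj₂ refl = t , p

  leg-neighbour : ∀ t i {v} → OnLeg t i → Adj R (leg t i) v →
                  v ≡ leg t (suc i) ⊎ Σ ℕ λ j → suc j ≡ i × 1 ≤ j × v ≡ leg t j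
  leg-neighbour t i I iv with toSpider iv
  ... | t′ , i′ , I′ , inj₁ (p , q) with leg-injective t t′ i i′ I I′ p
  ...   | refl , refl = inj₁ q
  leg-neighbour t i I iv | t′ , i′ , I′ , inj₂ (p , q) with next-onLeg-or-top t′ (proj₂ I′)
  ...   | inj₂ refl = ⊥-elim (leg≢apex t i I (trans q (leg-top t′)))
  ...   | inj₁ i′<len with leg-injective t t′ i (suc i′) I (s≤s z≤n , i′<len) q
  ...     | refl , refl = inj₂ (i′ , refl , proj₁ I′ , p)

  deg-apex : deg R a ≡ 3
  deg-apex = deg≡length R (top zero ∷ top (suc zero) ∷ top (suc (suc zero)) ∷ []) tops-unique nbr⊆
               (apex-adj-top _ ∷ apex-adj-top _ ∷ apex-adj-top _ ∷ [])
    where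
    top = λ t → leg t (len t)
    top-≢ : ∀ s t → s ≢ t → top s ≢ top t
    top-≢ s t s≢t = legs-disjoint s t _ _ s≢t (onLeg-top s) (onLeg-top t)
    tops-unique : Unique (top zero ∷ top (suc zero) ∷ top (suc (suc zero)) ∷ [])
    tops-unique = (top-≢ _ _ (λ ()) ∷ top-≢ _ _ (λ ()) ∷ []) ∷ (top-≢ _ _ (λ ()) ∷ []) ∷ [] ∷ []
    nbr⊆ : ∀ {u} → Adj R a u → u List.∈ (top zero ∷ top (suc zero) ∷ top (suc (suc zero)) ∷ [])
    nbr⊆ au with apex-neighbour au
    ... | zero , e = here e
    ... | suc zero , e = there (here e)
    ... | suc (suc zero) , e = there (there (here e))

  deg-foot : ∀ t → deg R (leg t 1) ≡ 1
  deg-foot t = deg≡length R (leg t 2 ∷ []) ([] ∷ []) nbr⊆ (leg-step t 1 (onLeg-1 t) ∷ [])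
    where
    nbr⊆ : ∀ {u} → Adj R (leg t 1) u → u List.∈ (leg t 2 ∷ [])
    nbr⊆ 1u with leg-neighbour t 1 (onLeg-1 t) 1u
    ... | inj₁ e = here e
    ... | inj₂ (zero , _ , () , _)
    ... | inj₂ (suc _ , () , _)

  deg-interior : ∀ t j → 1 ≤ j → suc j ≤ len t → deg R (leg t (suc j)) ≡ 2
  deg-interior t j 1≤j j<len = deg≡length R (leg t (suc (suc j)) ∷ leg t j ∷ []) ((ends-≢ ∷ []) ∷ [] ∷ []) nbr⊆
    (leg-step t (suc j) (s≤s z≤n , j<len) ∷ adj-sym R (leg-step t j (1≤j , j≤len)) ∷ [])
    where
    j≤len = ≤-trans (n≤1+n j) j<len
    ends-≢ : leg t (suc (suc j)) ≢ leg t j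
    ends-≢ e = <⇒≢ (m<n⇒m<1+n (n<1+n j))
      (sym (leg-cancel t _ _ (s≤s z≤n) (s≤s j<len) 1≤j (m≤n⇒m≤1+n j≤len) e))
    nbr⊆ : ∀ {u} → Adj R (leg t (suc j)) u → u List.∈ (leg t (suc (suc j)) ∷ leg t j ∷ [])
    nbr⊆ ju with leg-neighbour t (suc j) (s≤s z≤n , j<len) ju
    ... | inj₁ e = here e
    ... | inj₂ (_ , refl , _ , e) = there (here e)

  deg≡1⇒foot : ∀ w → deg R w ≡ 1 → Σ (Fin 3) λ t → w ≡ leg t 1
  deg≡1⇒foot w d with position w
  ... | inj₁ refl = ⊥-elim (3≢1 (trans (sym deg-apex) d))
    where
    3≢1 : 3 ≢ 1
    3≢1 ()
  ... | inj₂ (t , suc zero , _ , refl) = t , refl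
  ... | inj₂ (t , suc (suc j) , (_ , j<len) , refl) = ⊥-elim (2≢1 (trans (sym (deg-interior t (suc j) (s≤s z≤n) j<len)) d))
    where
    2≢1 : 2 ≢ 1
    2≢1 ()

  3≤deg⇒apex : ∀ w → 3 ≤ deg R w → w ≡ a
  3≤deg⇒apex w d with position w
  ... | inj₁ e = e
  ... | inj₂ (t , suc zero , _ , refl) = ⊥-elim (<⇒≱ (subst (_< 3) (sym (deg-foot t)) (s≤s (s≤s z≤n))) d)
  ... | inj₂ (t , suc (suc j) , (_ , j<len) , refl) =
    ⊥-elim (<⇒≱ (subst (_< 3) (sym (deg-interior t (suc j) (s≤s z≤n) j<len)) ≤-refl) d)

  deg-leg-next≢1 : ∀ t i → OnLeg t i → deg R (leg t (suc i)) ≢ 1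
  deg-leg-next≢1 t i (1≤i , i≤) d with deg≡1⇒foot _ d | next-onLeg-or-top t i≤
  ... | t′ , e | inj₁ i<len with leg-injective t t′ (suc i) 1 (s≤s z≤n , i<len) (onLeg-1 t′) e
  ...   | _ , e′ = <⇒≢ 1≤i (sym (suc-injective e′))
  deg-leg-next≢1 t i (1≤i , i≤) d | t′ , e | inj₂ refl =
    leg≢apex t′ 1 (onLeg-1 t′) (trans (sym e) (leg-top t))

  distOf : ∀ {w} → Position w → ℕ
  distOf (inj₁ _) = 0
  distOf (inj₂ (t , i , _ , _)) = suc (len t) ∸ i

  dist : Fin n → ℕ
  dist w = distOf (position w)

  dist-apex : dist a ≡ 0
  dist-apex with position a
  ... | inj₁ _ = refl
  ... | inj₂ (t , i , I , e) = ⊥-elim (leg≢apex t i I e)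

  distOf-leg : ∀ {w} (p : Position w) t i → OnLeg t i → leg t i ≡ w → distOf p ≡ suc (len t) ∸ i
  distOf-leg (inj₁ e) t i I e′ = ⊥-elim (leg≢apex t i I (trans e′ e))
  distOf-leg (inj₂ (t′ , i′ , I′ , e)) t i I e′ with leg-injective t t′ i i′ I I′ (trans e′ (sym e))
  ... | refl , refl = refl

  dist-leg : ∀ t i → 1 ≤ i → i ≤ suc (len t) → dist (leg t i) ≡ suc (len t) ∸ i
  dist-leg t i 1≤i i≤ with m≤n⇒m<n∨m≡n i≤
  ... | inj₁ i< = distOf-leg (position _) t i (1≤i , ≤-pred i<) refl
  ... | inj₂ refl = trans (cong dist (leg-top t)) (trans dist-apex (sym (n∸n≡0 (suc (len t)))))

  dist-step : ∀ t i → OnLeg t i → dist (leg t i) ≡ suc (dist (leg t (suc i)))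
  dist-step t i (1≤i , i≤) = begin
    dist (leg t i)                   ≡⟨ dist-leg t i 1≤i (m≤n⇒m≤1+n i≤) ⟩
    suc (len t) ∸ i                  ≡⟨ +-∸-assoc 1 i≤ ⟩
    suc (len t ∸ i)                  ≡⟨ cong suc (dist-leg t (suc i) (s≤s z≤n) (s≤s i≤)) ⟨
    suc (dist (leg t (suc i)))       ∎
    where open ≡-Reasoning

  spider-dist : ∀ {u v} → Adj R u v → dist u ≡ suc (dist v) ⊎ dist v ≡ suc (dist u)
  spider-dist uv with toSpider uv
  ... | t , i , I , inj₁ (refl , refl) = inj₁ (dist-step t i I)
  ... | t , i , I , inj₂ (refl , refl) = inj₂ (dist-step t i I)

  toward-apex : ∀ {w v} → Adj R w v → dist v < dist w →
                Σ (Fin 3) λ t → Σ ℕ λ i → OnLeg t i × w ≡ leg t i × v ≡ leg t (suc i)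
  toward-apex wv v<w with toSpider wv
  ... | t , i , I , inj₁ (p , q) = t , i , I , p , q
  ... | t , i , I , inj₂ (refl , refl) = ⊥-elim (n≮n _ (<-trans (n<1+n _) (subst (_< dist (leg t (suc i))) (dist-step t i I) v<w)))

  spider-parent-unique : ∀ {w u v} → Adj R w u → Adj R w v → dist u < dist w → dist v < dist w → u ≡ v
  spider-parent-unique wu wv u<w v<w with toward-apex wu u<w | toward-apex wv v<w
  ... | t , i , I , p , q | t′ , i′ , I′ , p′ , q′ with leg-injective t t′ i i′ I I′ (trans (sym p) p′)
  ...   | refl , refl = trans q (sym q′)

  open Graded R dist spider-dist spider-parent-unique using (triangleFree; acyclic)

  -- B as the line graph of R plus a clique

  legEdge : ∀ t i → OnLeg t i → Edge R
  legEdge t i I = edgeBetween R (leg t i) (leg t (suc i)) (leg-step t i I)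

  legEdge-on : ∀ t i I → EdgeOn R (legEdge t i I) (leg t i) (leg t (suc i))
  legEdge-on t i I = edgeBetween-on R _ _ _

  legEdge-irrelevant : ∀ t i I J → legEdge t i I ≡ legEdge t i J
  legEdge-irrelevant t i I J = edgeOn-unique R _ _ (legEdge-on t i I) (legEdge-on t i J)

  edge-onLeg : ∀ (e : Edge R) → Σ (Fin 3) λ t → Σ ℕ λ i → Σ (OnLeg t i) λ _ → EdgeOn R e (leg t i) (leg t (suc i))
  edge-onLeg (u , v , _ , uv) with toSpider uv
  ... | t , i , I , inj₁ (p , q) = t , i , I , inj₁ (p , q)
  ... | t , i , I , inj₂ (p , q) = t , i , I , inj₂ (q , p)

  -- dist drops by one along leg t i — leg t (i + 1), so no edge is listed in both orientations.
  leg-edge-orientation : ∀ t i t′ i′ → OnLeg t i → OnLeg t′ i′ →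
                         leg t′ i′ ≡ leg t (suc i) → leg t′ (suc i′) ≡ leg t i → ⊥
  leg-edge-orientation t i t′ i′ I I′ p q = <⇒≢ (m<n⇒m<1+n (n<1+n d)) (begin
    d                              ≡⟨ cong dist p ⟨
    dist (leg t′ i′)               ≡⟨ dist-step t′ i′ I′ ⟩
    suc (dist (leg t′ (suc i′)))   ≡⟨ cong (λ z → suc (dist z)) q ⟩
    suc (dist (leg t i))           ≡⟨ cong suc (dist-step t i I) ⟩
    suc (suc d)                    ∎)
    where
    open ≡-Reasoning
    d = dist (leg t (suc i))

  edgeOn-leg-unique : ∀ {t i t′ i′ e} → OnLeg t i → OnLeg t′ i′ →
                      EdgeOn R e (leg t i) (leg t (suc i)) → EdgeOn R e (leg t′ i′) (leg t′ (suc i′)) → t ≡ t′ × i ≡ i′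
  edgeOn-leg-unique {t} {i} {t′} {i′} I I′ (inj₁ (p , _)) (inj₁ (p′ , _)) =
    leg-injective t t′ i i′ I I′ (trans (sym p) p′)
  edgeOn-leg-unique {t} {i} {t′} {i′} I I′ (inj₂ (_ , q)) (inj₂ (_ , q′)) =
    leg-injective t t′ i i′ I I′ (trans (sym q) q′)
  edgeOn-leg-unique {t} {i} {t′} {i′} I I′ (inj₁ (p , q)) (inj₂ (p′ , q′)) =
    ⊥-elim (leg-edge-orientation t i t′ i′ I I′ (trans (sym q′) q) (trans (sym p′) p))
  edgeOn-leg-unique {t} {i} {t′} {i′} I I′ (inj₂ (p , q)) (inj₁ (p′ , q′)) =
    ⊥-elim (leg-edge-orientation t i t′ i′ I I′ (trans (sym p′) p) (trans (sym q′) q))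

  elementOf : ∀ {w} → Position w → Edge R ⊎ Fin 1
  elementOf (inj₁ _) = inj₂ zero
  elementOf (inj₂ (t , i , I , _)) = inj₁ (legEdge t i I)

  toElement : Fin n → Edge R ⊎ Fin 1
  toElement w = elementOf (position w)

  fromElement : Edge R ⊎ Fin 1 → Fin n
  fromElement (inj₂ _) = a
  fromElement (inj₁ e) with edge-onLeg e
  ... | t , i , _ = leg t i

  fromElement-legEdge : ∀ t i I → fromElement (inj₁ (legEdge t i I)) ≡ leg t i
  fromElement-legEdge t i I with edge-onLeg (legEdge t i I)
  ... | t′ , i′ , I′ , on with edgeOn-leg-unique {e = legEdge t i I} I I′ (legEdge-on t i I) on
  ...   | refl , refl = refl

  legEdge-injective : ∀ s i t j I J → legEdge s i I ≡ legEdge t j J → leg s i ≡ leg t j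
  legEdge-injective s i t j I J e =
    trans (sym (fromElement-legEdge s i I)) (trans (cong (λ z → fromElement (inj₁ z)) e) (fromElement-legEdge t j J))

  from-toElement : ∀ w → fromElement (toElement w) ≡ w
  from-toElement w with position w
  ... | inj₁ e = sym e
  ... | inj₂ (t , i , I , e) = trans (fromElement-legEdge t i I) e

  toElement-apex : toElement a ≡ inj₂ zero
  toElement-apex with position a
  ... | inj₁ _ = refl
  ... | inj₂ (t , i , I , e) = ⊥-elim (leg≢apex t i I e)

  toElement-leg : ∀ t i I → toElement (leg t i) ≡ inj₁ (legEdge t i I)
  toElement-leg t i I with position (leg t i)
  ... | inj₁ e = ⊥-elim (leg≢apex t i I e)
  ... | inj₂ (t′ , i′ , I′ , e) with leg-injective t′ t i′ i I′ I e
  ...   | refl , refl = cong inj₁ (legEdge-irrelevant t i I′ I)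

  to-fromElement : ∀ x → toElement (fromElement x) ≡ x
  to-fromElement (inj₂ zero) = toElement-apex
  to-fromElement (inj₁ e) with edge-onLeg e
  ... | t , i , I , on = trans (toElement-leg t i I) (cong inj₁ (edgeOn-unique R _ _ (legEdge-on t i I) on))

  φ : Fin n ↔ (Edge R ⊎ Fin 1)
  φ = mk↔ₛ′ toElement fromElement to-fromElement from-toElement

  leg-next≡leg : ∀ s i t j → OnLeg s i → OnLeg t j → leg s (suc i) ≡ leg t j → s ≡ t × suc i ≡ j
  leg-next≡leg s i t j I J e with next-onLeg-or-top s (proj₂ I)
  ... | inj₁ i<len = leg-injective s t (suc i) j (s≤s z≤n , i<len) J e
  ... | inj₂ refl = ⊥-elim (leg≢apex t j J (trans (sym e) (leg-top s)))

  leg-next-injective : ∀ s i t j → OnLeg s i → OnLeg t j → leg s (suc i) ≡ leg t (suc j) →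
                       (s ≡ t × i ≡ j) ⊎ (i ≡ len s × j ≡ len t)
  leg-next-injective s i t j I J e with next-onLeg-or-top s (proj₂ I) | next-onLeg-or-top t (proj₂ J)
  ... | inj₁ i<len | _ with leg-next≡leg t j s (suc i) J (s≤s z≤n , i<len) (sym e)
  ...   | refl , refl = inj₁ (refl , refl)
  leg-next-injective s i t j I J e | inj₂ refl | inj₁ j<len =
    ⊥-elim (leg≢apex t (suc j) (s≤s z≤n , j<len) (trans (sym e) (leg-top s)))
  leg-next-injective s i t j I J e | inj₂ refl | inj₂ refl = inj₂ (refl , refl)

  PathAdj : Fin n → Fin n → Set
  PathAdj u v = Σ (Fin 3) λ t → Σ ℕ λ i → i < len t × LegEdge t i u v

  TriangleAdj : Fin n → Fin n → Set
  TriangleAdj u v = Σ (Fin 3) λ s → Σ (Fin 3) λ t → s ≢ t × u ≡ leg s (len s) × v ≡ leg t (len t)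

  vtx-inject₁ : ∀ t (k : Fin (len t)) → vtx (P t) (inject₁ k) ≡ leg t (toℕ k)
  vtx-inject₁ t k = trans (leg-vtx t (inject₁ k)) (cong (leg t) (toℕ-inject₁ k))

  B-adj⁻ : ∀ {u v} → Adj B u v → PathAdj u v ⊎ TriangleAdj u v
  B-adj⁻ {u} {v} uv with proj₁ (edges u v) uv
  ... | inj₁ (t , k , inj₁ (p , q)) =
    inj₁ (t , toℕ k , toℕ<n k , inj₁ (trans (sym p) (vtx-inject₁ t k) , trans (sym q) (leg-vtx t (suc k))))
  ... | inj₁ (t , k , inj₂ (p , q)) =
    inj₁ (t , toℕ k , toℕ<n k , inj₂ (trans (sym p) (vtx-inject₁ t k) , trans (sym q) (leg-vtx t (suc k))))
  ... | inj₂ (s , t , s≢t , p , q) = inj₂ (s , t , s≢t , trans p (leg-end s) , trans q (leg-end t))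

  B-leg-step : ∀ t i → i < len t → Adj B (leg t i) (leg t (suc i))
  B-leg-step t i i<len = proj₂ (edges _ _) (inj₁ (t , k , inj₁ (vtx-k , vtx-suc-k)))
    where
    k = fromℕ< i<len
    vtx-k : vtx (P t) (inject₁ k) ≡ leg t i
    vtx-k = trans (vtx-inject₁ t k) (cong (leg t) (toℕ-fromℕ< i<len))
    vtx-suc-k : vtx (P t) (suc k) ≡ leg t (suc i)
    vtx-suc-k = trans (leg-vtx t (suc k)) (cong (λ z → leg t (suc z)) (toℕ-fromℕ< i<len))

  B-triangle : ∀ s t → s ≢ t → Adj B (leg s (len s)) (leg t (len t))
  B-triangle s t s≢t = proj₂ (edges _ _) (inj₂ (s , t , s≢t , sym (leg-end s) , sym (leg-end t)))

  lab : Edge R → Fin 1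
  lab _ = zero

  B-apex⁻ : ∀ t i → OnLeg t i → Adj B a (leg t i) → i ≡ 1
  B-apex⁻ t i I ai with B-adj⁻ ai
  ... | inj₂ (s , _ , _ , p , _) = ⊥-elim (leg≢apex s (len s) (onLeg-top s) (sym p))
  ... | inj₁ (t′ , i′ , i′<len , inj₂ (_ , q)) = ⊥-elim (leg≢apex t′ (suc i′) (s≤s z≤n , i′<len) (sym q))
  ... | inj₁ (t′ , suc i′ , i′<len , inj₁ (p , _)) = ⊥-elim (leg≢apex t′ (suc i′) (s≤s z≤n , <⇒≤ i′<len) (sym p))
  ... | inj₁ (t′ , zero , _ , inj₁ (_ , q)) = proj₂ (leg-injective t t′ i 1 I (onLeg-1 t′) q)

  B-apex-foot : ∀ t → Adj B a (leg t 1)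
  B-apex-foot t = subst (λ z → Adj B z (leg t 1)) (leg-zero t) (B-leg-step t 0 (len≥1 t))

  edgeOn-leg-pendant⁻ : ∀ e {t i} → OnLeg t i → EdgeOn R e (leg t i) (leg t (suc i)) → Pendant R e → i ≡ 1
  edgeOn-leg-pendant⁻ e {t} {i} I on p with pendant-edgeOn R e on p
  ... | inj₂ d = ⊥-elim (deg-leg-next≢1 t i I d)
  ... | inj₁ d with deg≡1⇒foot _ d
  ...   | t′ , e′ = proj₂ (leg-injective t t′ i 1 I (onLeg-1 t′) e′)

  legEdge-foot-pendant : ∀ t I → Pendant R (legEdge t 1 I)
  legEdge-foot-pendant t I = edgeOn-pendant R (legEdge t 1 I) (legEdge-on t 1 I) (inj₁ (deg-foot t))

  B-apex-iff : ∀ t i I → Iff (Adj B a (leg t i)) (Pendant R (legEdge t i I) × lab (legEdge t i I) ≡ zero)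
  B-apex-iff t i I = to , from
    where
    to : Adj B a (leg t i) → Pendant R (legEdge t i I) × lab (legEdge t i I) ≡ zero
    to ai with B-apex⁻ t i I ai
    ... | refl = legEdge-foot-pendant t I , refl
    from : Pendant R (legEdge t i I) × lab (legEdge t i I) ≡ zero → Adj B a (leg t i)
    from (p , _) with edgeOn-leg-pendant⁻ (legEdge t i I) I (legEdge-on t i I) p
    ... | refl = B-apex-foot t

  Share : Edge R → Edge R → Set
  Share e f = ∃[ x ] (Incident R e x × Incident R f x)

  share-path-edge : ∀ s i t j I J t′ i′ → i′ < len t′ → leg s i ≡ leg t′ i′ → leg t j ≡ leg t′ (suc i′) →
                    Share (legEdge s i I) (legEdge t j J)
  share-path-edge s i t j I J t′ zero _ p _ = ⊥-elim (leg≢apex s i I (trans p (leg-zero t′)))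
  share-path-edge s i t j I J t′ (suc k) k<len p q with leg-injective s t′ i (suc k) I (s≤s z≤n , <⇒≤ k<len) p
  ... | refl , refl with leg-next≡leg s i t j I J (sym q)
  ...   | refl , refl = leg s (suc i) , edgeOn-incident R (legEdge s i I) (legEdge-on s i I) (inj₂ refl)
                                      , edgeOn-incident R (legEdge t j J) (legEdge-on t j J) (inj₁ refl)

  B-legs⁻ : ∀ s i t j I J → Adj B (leg s i) (leg t j) → PAdj R lab (inj₁ (legEdge s i I)) (inj₁ (legEdge t j J))
  B-legs⁻ s i t j I J ij = edges-≢ , share (B-adj⁻ ij)
    where
    edges-≢ : legEdge s i I ≢ legEdge t j J
    edges-≢ e = adj-irrefl B (subst (Adj B (leg s i)) (sym (legEdge-injective s i t j I J e)) ij)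
    share : PathAdj (leg s i) (leg t j) ⊎ TriangleAdj (leg s i) (leg t j) → Share (legEdge s i I) (legEdge t j J)
    share (inj₁ (t′ , i′ , i′<len , inj₁ (p , q))) = share-path-edge s i t j I J t′ i′ i′<len p q
    share (inj₁ (t′ , i′ , i′<len , inj₂ (p , q))) with share-path-edge t j s i J I t′ i′ i′<len p q
    ... | x , xs , xt = x , xt , xs
    share (inj₂ (s′ , t′ , _ , p , q)) with leg-injective s s′ i (len s′) I (onLeg-top s′) p
                                          | leg-injective t t′ j (len t′) J (onLeg-top t′) q
    ... | refl , refl | refl , refl = a , edgeOn-incident R (legEdge s i I) (legEdge-on s i I) (inj₂ (sym (leg-top s)))
                                        , edgeOn-incident R (legEdge t j J) (legEdge-on t j J) (inj₂ (sym (leg-top t)))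

  B-legs⁺ : ∀ s i t j I J → PAdj R lab (inj₁ (legEdge s i I)) (inj₁ (legEdge t j J)) → Adj B (leg s i) (leg t j)
  B-legs⁺ s i t j I J (edges-≢ , x , xs , xt)
    with incident-edgeOn R (legEdge s i I) (legEdge-on s i I) xs | incident-edgeOn R (legEdge t j J) (legEdge-on t j J) xt
  ... | inj₁ refl | inj₁ e with leg-injective s t i j I J e
  ...   | refl , refl = ⊥-elim (edges-≢ (legEdge-irrelevant s i I J))
  B-legs⁺ s i t j I J (edges-≢ , x , xs , xt) | inj₁ refl | inj₂ e with leg-next≡leg t j s i J I (sym e)
  ...   | refl , refl = adj-sym B (B-leg-step t j (proj₂ I))
  B-legs⁺ s i t j I J (edges-≢ , x , xs , xt) | inj₂ refl | inj₁ e with leg-next≡leg s i t j I J e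
  ...   | refl , refl = B-leg-step s i (proj₂ J)
  B-legs⁺ s i t j I J (edges-≢ , x , xs , xt) | inj₂ refl | inj₂ e with leg-next-injective s i t j I J e
  ...   | inj₁ (refl , refl) = ⊥-elim (edges-≢ (legEdge-irrelevant s i I J))
  ...   | inj₂ (refl , refl) with s ≟ᶠ t
  ...     | yes refl = ⊥-elim (edges-≢ (legEdge-irrelevant s i I J))
  ...     | no s≢t = B-triangle s t s≢t

  toElement-adj : ∀ u v → Iff (Adj B u v) (PAdj R lab (Inverse.to φ u) (Inverse.to φ v))
  toElement-adj u v with position u | position v
  ... | inj₁ refl | inj₁ refl = (λ aa → ⊥-elim (adj-irrefl B aa)) , (λ 0≢0 → ⊥-elim (0≢0 refl))
  ... | inj₁ refl | inj₂ (t , i , I , refl) = B-apex-iff t i I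
  ... | inj₂ (t , i , I , refl) | inj₁ refl =
    (λ ia → proj₁ (B-apex-iff t i I) (adj-sym B ia)) , (λ p → adj-sym B (proj₂ (B-apex-iff t i I) p))
  ... | inj₂ (s , i , I , refl) | inj₂ (t , j , J , refl) = B-legs⁻ s i t j I J , B-legs⁺ s i t j I J

  -- Paths and components of R

  closedLeg-adj : ∀ t m m′ → 1 ≤ m → m ≤ suc (len t) → 1 ≤ m′ → m′ ≤ suc (len t) →
                  Adj R (leg t m) (leg t m′) → suc m ≡ m′ ⊎ suc m′ ≡ m
  closedLeg-adj t m m′ 1≤m m≤ 1≤m′ m′≤ mm′ with spider-dist mm′
  ... | inj₁ e = inj₁ (suc[ℓ∸a]≡ℓ∸b⇒suc[b]≡a m′≤ m≤ (trans (cong suc (sym (dist-leg t m′ 1≤m′ m′≤)))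
                                                       (trans (sym e) (dist-leg t m 1≤m m≤))))
  ... | inj₂ e = inj₂ (suc[ℓ∸a]≡ℓ∸b⇒suc[b]≡a m≤ m′≤ (trans (cong suc (sym (dist-leg t m 1≤m m≤)))
                                                       (trans (sym e) (dist-leg t m′ 1≤m′ m′≤))))

  legSegment : ∀ t k k′ → 1 ≤ k → k ≤ k′ → k′ ≤ suc (len t) → ChordlessSeq R (k′ ∸ k)
  legSegment t k k′ 1≤k k≤k′ k′≤ = record
    { at           = λ i → leg t (k + i)
    ; at-injective = λ i j i≤ j≤ e → +-cancelˡ-≡ k i j (leg-cancel t _ _ (lo i) (hi i≤) (lo j) (hi j≤) e)
    ; at-step      = λ i i< → subst (λ z → Adj R (leg t (k + i)) (leg t z)) (sym (+-suc k i))
                                (leg-step t (k + i) (lo i , ≤-pred (subst (_≤ suc (len t)) (+-suc k i) (hi i<))))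
    ; at-chordless = λ i j i≤ j≤ ij → cancel (closedLeg-adj t _ _ (lo i) (hi i≤) (lo j) (hi j≤) ij) }
    where
    lo : ∀ i → 1 ≤ k + i
    lo i = ≤-trans 1≤k (m≤m+n k i)
    hi : ∀ {i} → i ≤ k′ ∸ k → k + i ≤ suc (len t)
    hi i≤ = ≤-trans (≤-trans (+-monoʳ-≤ k i≤) (≤-reflexive (m+[n∸m]≡n k≤k′))) k′≤
    cancel : ∀ {i j} → suc (k + i) ≡ k + j ⊎ suc (k + j) ≡ k + i → suc i ≡ j ⊎ suc j ≡ i
    cancel (inj₁ e) = inj₁ (+-cancelˡ-≡ k _ _ (trans (+-suc k _) e))
    cancel (inj₂ e) = inj₂ (+-cancelˡ-≡ k _ _ (trans (+-suc k _) e))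

  Between : ℕ → ℕ → ℕ → Set
  Between i j m = (i ≤ m ⊎ j ≤ m) × (m ≤ i ⊎ m ≤ j)

  walk-down : ∀ {S} t i j → 1 ≤ i → i ≤ j → j ≤ suc (len t) →
              (∀ m → i ≤ m → m ≤ j → S (leg t m)) → Reach R S (leg t j) (leg t i)
  walk-down t i zero 1≤i i≤j _ _ = ⊥-elim (<⇒≱ 1≤i i≤j)
  walk-down t i (suc j) 1≤i i≤j j≤ S-on with m≤n⇒m<n∨m≡n i≤j
  ... | inj₂ refl = r-here (S-on (suc j) ≤-refl ≤-refl)
  ... | inj₁ i<j = r-step (S-on (suc j) i≤j ≤-refl)
                          (adj-sym R (leg-step t j (≤-trans 1≤i (≤-pred i<j) , ≤-pred j≤)))
                          (walk-down t i j 1≤i (≤-pred i<j) (m≤n⇒m≤1+n (≤-pred j≤))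
                                     (λ m i≤m m≤j → S-on m i≤m (m≤n⇒m≤1+n m≤j)))

  walk-leg : ∀ {S} t i j → 1 ≤ i → i ≤ suc (len t) → 1 ≤ j → j ≤ suc (len t) →
             (∀ m → Between i j m → S (leg t m)) → Reach R S (leg t i) (leg t j)
  walk-leg t i j 1≤i i≤ 1≤j j≤ S-on with ≤-total i j
  ... | inj₁ i≤j = reach-sym R (walk-down t i j 1≤i i≤j j≤ (λ m i≤m m≤j → S-on m (inj₁ i≤m , inj₂ m≤j)))
  ... | inj₂ j≤i = walk-down t j i 1≤j j≤i i≤ (λ m j≤m m≤i → S-on m (inj₂ j≤m , inj₁ m≤i))

  reach-apex : ∀ u → Reach R (λ _ → ⊤) u a
  reach-apex u with position u
  ... | inj₁ refl = r-here tt
  ... | inj₂ (t , i , (1≤i , i≤) , refl) =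
    subst (Reach R _ (leg t i)) (leg-top t) (walk-leg t i (suc (len t)) 1≤i (m≤n⇒m≤1+n i≤) (s≤s z≤n) ≤-refl (λ _ _ → tt))

  connected : Connected R
  connected u v = reach-trans R (reach-apex u) (reach-sym R (reach-apex v))

  third : ∀ s t → Σ (Fin 3) λ u → u ≢ s × u ≢ t
  third zero zero = suc zero , (λ ()) , (λ ())
  third zero (suc zero) = suc (suc zero) , (λ ()) , (λ ())
  third zero (suc (suc zero)) = suc zero , (λ ()) , (λ ())
  third (suc zero) zero = suc (suc zero) , (λ ()) , (λ ())
  third (suc zero) (suc zero) = zero , (λ ()) , (λ ())
  third (suc zero) (suc (suc zero)) = zero , (λ ()) , (λ ())
  third (suc (suc zero)) zero = suc zero , (λ ()) , (λ ())
  third (suc (suc zero)) (suc zero) = zero , (λ ()) , (λ ())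
  third (suc (suc zero)) (suc (suc zero)) = zero , (λ ()) , (λ ())

  legOf : ∀ {w} → Position w → Fin 3
  legOf (inj₁ _) = zero
  legOf (inj₂ (t , _)) = t

  off-leg : ∀ {w} (p : Position w) t → t ≢ legOf p → ∀ m → OnLeg t m → leg t m ≢ w
  off-leg (inj₁ refl) t _ m M = leg≢apex t m M
  off-leg (inj₂ (s , k , K , refl)) t t≢s m M = legs-disjoint t s m k t≢s M K

  free-leg : ∀ x y → Σ (Fin 3) λ t → ∀ m → OnLeg t m → leg t m ≢ x × leg t m ≢ y
  free-leg x y with third (legOf (position x)) (legOf (position y))
  ... | t , t≢x , t≢y = t , λ m M → off-leg (position x) t t≢x m M , off-leg (position y) t t≢y m M

  Below Above Aside : Fin 3 → ℕ → Fin n → Set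
  Below t j z = Σ ℕ λ k → 1 ≤ k × k < j × z ≡ leg t k
  Above t j z = Σ ℕ λ k → j < k × k ≤ suc (len t) × z ≡ leg t k
  Aside t j z = Σ (Fin 3) λ s → Σ ℕ λ k → s ≢ t × OnLeg s k × z ≡ leg s k

  classify : ∀ t j → j ≤ len t → ∀ z → z ≢ leg t j → Below t j z ⊎ Above t j z ⊎ Aside t j z
  classify t j j≤ z z≢j with position z
  ... | inj₁ e = inj₂ (inj₁ (suc (len t) , s≤s j≤ , ≤-refl , trans e (sym (leg-top t))))
  ... | inj₂ (s , k , K , e) with s ≟ᶠ t
  ...   | no s≢t = inj₂ (inj₂ (s , k , s≢t , K , sym e))
  ...   | yes refl with <-cmp k j
  ...     | tri< k<j _ _ = inj₁ (k , proj₁ K , k<j , sym e)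
  ...     | tri≈ _ refl _ = ⊥-elim (z≢j (sym e))
  ...     | tri> _ _ j<k = inj₂ (inj₁ (k , j<k , m≤n⇒m≤1+n (proj₂ K) , sym e))

  not-below : ∀ t j z → j ≤ len t → Above t j z ⊎ Aside t j z → ∀ m → 1 ≤ m → m ≤ j → leg t m ≢ z
  not-below t j z j≤ (inj₁ (k , j<k , k≤ , refl)) m 1≤m m≤j e =
    <⇒≱ j<k (subst (_≤ j) (leg-cancel t m k 1≤m (m≤n⇒m≤1+n (≤-trans m≤j j≤)) (≤-trans (s≤s z≤n) j<k) k≤ e) m≤j)
  not-below t j z j≤ (inj₂ (s , k , s≢t , K , refl)) m 1≤m m≤j =
    legs-disjoint t s m k (λ e → s≢t (sym e)) (1≤m , ≤-trans m≤j j≤) K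

  not-above : ∀ t j z → 1 ≤ j → j ≤ len t → Below t j z ⊎ Aside t j z →
              (∀ m → j ≤ m → m ≤ len t → leg t m ≢ z) × a ≢ z
  not-above t j z 1≤j j≤ (inj₁ (k , 1≤k , k<j , refl)) =
    (λ m j≤m m≤ e → <⇒≱ k<j (subst (j ≤_) (proj₂ (leg-injective t t m k (≤-trans 1≤j j≤m , m≤) K e)) j≤m)) ,
    (λ e → leg≢apex t k K (sym e))
    where K = 1≤k , ≤-trans (<⇒≤ k<j) j≤
  not-above t j z 1≤j j≤ (inj₂ (s , k , s≢t , K , refl)) =
    (λ m j≤m m≤ → legs-disjoint t s m k (λ e → s≢t (sym e)) (≤-trans 1≤j j≤m , m≤) K) ,
    (λ e → leg≢apex s k K (sym e))

  PathComponent : Fin n → Fin n → Subset n → Set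
  PathComponent x y C = Σ ℕ λ ℓ → Σ (Path R ℓ) λ Q → ChordlessPath R Q × start Q ≡ x × end Q ≡ y ×
                          (∀ v → Iff (v ∈ C ⊎ (v ≡ x ⊎ v ≡ y)) (OnPath R Q v))

  -- Components of R − {x, y}; x = y is allowed and covers cut vertices.
  module Component {X : Fin n → Set} {C : Subset n} (IC : IsComponent R X C)
                   {x y : Fin n} (X⇔ : ∀ w → Iff (X w) (w ≡ x ⊎ w ≡ y)) where

    Foot : Set
    Foot = ∃[ v ] (v ∈ C × deg R v ≡ 1)

    ¬X : ∀ {w} → w ≢ x → w ≢ y → ¬ X w
    ¬X w≢x w≢y Xw with proj₁ (X⇔ _) Xw
    ... | inj₁ e = w≢x e
    ... | inj₂ e = w≢y e

    leg-∈C : ∀ t {i j} → 1 ≤ i → i ≤ suc (len t) → 1 ≤ j → j ≤ suc (len t) →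
             (∀ m → Between i j m → ¬ X (leg t m)) → leg t i ∈ C → leg t j ∈ C
    leg-∈C t 1≤i i≤ 1≤j j≤ free i∈C = component-reach R IC i∈C (walk-leg t _ _ 1≤i i≤ 1≤j j≤ free)

    closedLeg-free : ∀ t {lo} → ¬ X a → (∀ m → lo ≤ m → m ≤ len t → ¬ X (leg t m)) →
                     ∀ m → lo ≤ m → m ≤ suc (len t) → ¬ X (leg t m)
    closedLeg-free t ¬Xa free m lo≤m m≤ with m≤n⇒m<n∨m≡n m≤
    ... | inj₁ m<  = free m lo≤m (≤-pred m<)
    ... | inj₂ refl = subst (λ z → ¬ X z) (sym (leg-top t)) ¬Xa

    down-foot : ∀ t j → OnLeg t j → leg t j ∈ C → (∀ m → 1 ≤ m → m ≤ j → ¬ X (leg t m)) → Foot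
    down-foot t j (1≤j , j≤) j∈C free =
      leg t 1 , leg-∈C t 1≤j (m≤n⇒m≤1+n j≤) (s≤s z≤n) (s≤s z≤n) free′ j∈C , deg-foot t
      where
      free′ : ∀ m → Between j 1 m → ¬ X (leg t m)
      free′ m (lower , upper) = free m ([ ≤-trans 1≤j , id ]′ lower) ([ id , (λ m≤1 → ≤-trans m≤1 1≤j) ]′ upper)

    up-apex : ∀ t j → OnLeg t j → leg t j ∈ C → (∀ m → j ≤ m → m ≤ len t → ¬ X (leg t m)) → ¬ X a → a ∈ C
    up-apex t j (1≤j , j≤) j∈C free ¬Xa =
      subst (_∈ C) (leg-top t) (leg-∈C t 1≤j (m≤n⇒m≤1+n j≤) (s≤s z≤n) ≤-refl free′ j∈C)
      where
      free′ : ∀ m → Between j (suc (len t)) m → ¬ X (leg t m)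
      free′ m (lower , upper) = closedLeg-free t ¬Xa free m ([ id , ≤-trans (m≤n⇒m≤1+n j≤) ]′ lower)
                                  ([ (λ m≤j → ≤-trans m≤j (m≤n⇒m≤1+n j≤)) , id ]′ upper)

    apex-foot : ∀ t → a ∈ C → (∀ m → OnLeg t m → ¬ X (leg t m)) → Foot
    apex-foot t a∈C free = leg t 1 , leg∈C , deg-foot t
      where
      ¬Xa = IsComponent.avoid IC a a∈C
      free′ : ∀ m → Between (suc (len t)) 1 m → ¬ X (leg t m)
      free′ m (lower , upper) = closedLeg-free t ¬Xa (λ m 1≤m m≤ → free m (1≤m , m≤)) m
        ([ ≤-trans (s≤s z≤n) , id ]′ lower) ([ id , (λ m≤1 → ≤-trans m≤1 (s≤s z≤n)) ]′ upper)
      leg∈C = leg-∈C t (s≤s z≤n) ≤-refl (s≤s z≤n) (s≤s z≤n) free′ (subst (_∈ C) (sym (leg-top t)) a∈C)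

    foot-from-apex : a ∈ C → Foot
    foot-from-apex a∈C with free-leg x y
    ... | t , free = apex-foot t a∈C λ m M → ¬X (proj₁ (free m M)) (proj₂ (free m M))

    pathComponent : ∀ {ℓ} (S : ChordlessSeq R ℓ) → ChordlessSeq.at S 0 ≡ x → ChordlessSeq.at S ℓ ≡ y →
                    (∀ v → Iff (v ∈ C ⊎ X v) (OnPath R (toPath R S) v)) → PathComponent x y C
    pathComponent S s≡x e≡y on⇔ = _ , toPath R S , toPath-chordless R S , s≡x , trans (toPath-end R S) e≡y ,
      λ v → (λ p → proj₁ (on⇔ v) (map₂ (proj₂ (X⇔ v)) p)) ,
            (λ o → map₂ (proj₁ (X⇔ v)) (proj₂ (on⇔ v) o))

    -- If X = {leg t k, leg t k′} cuts off the vertex leg t j lying between them, its component is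
    -- the open segment from k to k′.
    module Segment (t : Fin 3) {j k k′ : ℕ} (1≤k : 1 ≤ k) (k<j : k < j) (j<k′ : j < k′) (k′≤ : k′ ≤ suc (len t))
                   (j∈C : leg t j ∈ C) (X⇔ends : ∀ w → Iff (X w) (w ≡ leg t k ⊎ w ≡ leg t k′)) where

      Inside : Fin n → Set
      Inside w = Σ ℕ λ m → k < m × m < k′ × leg t m ≡ w

      k<k′ : k < k′
      k<k′ = <-trans k<j j<k′

      inside-step : ∀ {w v} → Inside w → Adj R w v → ¬ X v → Inside v
      inside-step (m , k<m , m<k′ , refl) mv ¬Xv
        with leg-neighbour t m (≤-trans 1≤k (<⇒≤ k<m) , ≤-pred (≤-trans m<k′ k′≤)) mv
      ... | inj₁ refl with m≤n⇒m<n∨m≡n m<k′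
      ...   | inj₁ m+1<k′ = suc m , m<n⇒m<1+n k<m , m+1<k′ , refl
      ...   | inj₂ refl = ⊥-elim (¬Xv (proj₂ (X⇔ends _) (inj₂ refl)))
      inside-step (m , k<m , m<k′ , refl) mv ¬Xv | inj₂ (i , refl , _ , refl) with m≤n⇒m<n∨m≡n (≤-pred k<m)
      ...   | inj₁ k<i = i , k<i , <-trans (n<1+n i) m<k′ , refl
      ...   | inj₂ refl = ⊥-elim (¬Xv (proj₂ (X⇔ends _) (inj₁ refl)))

      reach-inside : ∀ {w v} → Inside w → Reach R (λ z → ¬ X z) w v → Inside v
      reach-inside w-in (r-here _) = w-in
      reach-inside w-in (r-step _ wv r) = reach-inside (inside-step w-in wv (reach-head R r)) r

      ∈C⇒inside : ∀ w → w ∈ C → Inside w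
      ∈C⇒inside w w∈C = reach-inside (j , k<j , j<k′ , refl) (IsComponent.conn IC _ w j∈C w∈C)

      inside-¬X : ∀ i → k < i → i < k′ → ¬ X (leg t i)
      inside-¬X i k<i i<k′ Xi =
        [ (λ e → <⇒≢ k<i (sym (cancel k 1≤k (≤-trans (<⇒≤ k<k′) k′≤) e)))
        , (λ e → <⇒≢ i<k′ (cancel k′ (≤-trans 1≤k (<⇒≤ k<k′)) k′≤ e)) ]′ (proj₁ (X⇔ends _) Xi)
        where
        cancel : ∀ l → 1 ≤ l → l ≤ suc (len t) → leg t i ≡ leg t l → i ≡ l
        cancel l = leg-cancel t i l (≤-trans 1≤k (<⇒≤ k<i)) (≤-trans (<⇒≤ i<k′) k′≤)

      inside⇒∈C : ∀ m → k < m → m < k′ → leg t m ∈ C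
      inside⇒∈C m k<m m<k′ =
        leg-∈C t (≤-trans 1≤k (<⇒≤ k<j)) (≤-trans (<⇒≤ j<k′) k′≤) (≤-trans 1≤k (<⇒≤ k<m)) (≤-trans (<⇒≤ m<k′) k′≤)
               (λ i (lower , upper) → inside-¬X i ([ <-≤-trans k<j , <-≤-trans k<m ]′ lower)
                                                   ([ (λ i≤j → ≤-<-trans i≤j j<k′) , (λ i≤m → ≤-<-trans i≤m m<k′) ]′ upper))
               j∈C

      segment : ChordlessSeq R (k′ ∸ k)
      segment = legSegment t k k′ 1≤k (<⇒≤ k<k′) k′≤

      k+[k′∸k]≤k′ : k + (k′ ∸ k) ≤ k′
      k+[k′∸k]≤k′ = ≤-reflexive (m+[n∸m]≡n (<⇒≤ k<k′))

      segment-start : ChordlessSeq.at segment 0 ≡ leg t k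
      segment-start = cong (leg t) (+-identityʳ k)

      segment-end : ChordlessSeq.at segment (k′ ∸ k) ≡ leg t k′
      segment-end = cong (leg t) (m+[n∸m]≡n (<⇒≤ k<k′))

      segment-on⇔ : ∀ v → Iff (v ∈ C ⊎ X v) (OnPath R (toPath R segment) v)
      segment-on⇔ v = to , from
        where
        on-segment : ∀ m → k ≤ m → m ≤ k′ → leg t m ≡ v → OnPath R (toPath R segment) v
        on-segment m k≤m m≤k′ e =
          onPath-toPath⁺ R segment (m ∸ k) (∸-monoˡ-≤ k m≤k′) (trans (cong (leg t) (m+[n∸m]≡n k≤m)) e)
        to : v ∈ C ⊎ X v → OnPath R (toPath R segment) v
        to (inj₁ v∈C) with ∈C⇒inside v v∈C
        ... | m , k<m , m<k′ , e = on-segment m (<⇒≤ k<m) (<⇒≤ m<k′) e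
        to (inj₂ Xv) with proj₁ (X⇔ends v) Xv
        ... | inj₁ e = on-segment k ≤-refl (<⇒≤ k<k′) (sym e)
        ... | inj₂ e = on-segment k′ (<⇒≤ k<k′) ≤-refl (sym e)
        from : OnPath R (toPath R segment) v → v ∈ C ⊎ X v
        from o with onPath-toPath⁻ R segment o
        ... | i , i≤ , refl with m≤n⇒m<n∨m≡n (m≤m+n k i) | m≤n⇒m<n∨m≡n (≤-trans (+-monoʳ-≤ k i≤) k+[k′∸k]≤k′)
        ...   | inj₂ e | _ = inj₂ (proj₂ (X⇔ends _) (inj₁ (cong (leg t) (sym e))))
        ...   | inj₁ _ | inj₂ e = inj₂ (proj₂ (X⇔ends _) (inj₂ (cong (leg t) e)))
        ...   | inj₁ k< | inj₁ <k′ = inj₁ (inside⇒∈C (k + i) k< <k′)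

    ends-iff : ∀ {u v} → x ≡ u → y ≡ v → ∀ w → Iff (X w) (w ≡ u ⊎ w ≡ v)
    ends-iff refl refl = X⇔

    ends-iff-swap : ∀ {u v} → x ≡ v → y ≡ u → ∀ w → Iff (X w) (w ≡ u ⊎ w ≡ v)
    ends-iff-swap refl refl w = (λ Xw → swap (proj₁ (X⇔ w) Xw)) , (λ e → proj₂ (X⇔ w) (swap e))

    foot-or-path-from-leg : ∀ t j → OnLeg t j → leg t j ∈ C → PathComponent x y C ⊎ Foot
    foot-or-path-from-leg t j J@(1≤j , j≤) j∈C = cases (classify t j j≤ x x≢j) (classify t j j≤ y y≢j)
      where
      x≢j : x ≢ leg t j
      x≢j e = IsComponent.avoid IC _ j∈C (proj₂ (X⇔ _) (inj₁ (sym e)))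
      y≢j : y ≢ leg t j
      y≢j e = IsComponent.avoid IC _ j∈C (proj₂ (X⇔ _) (inj₂ (sym e)))

      via-apex : Below t j x ⊎ Aside t j x → Below t j y ⊎ Aside t j y → Foot
      via-apex bx by = foot-from-apex (up-apex t j J j∈C
        (λ m j≤m m≤ → ¬X (proj₁ (not-above t j x 1≤j j≤ bx) m j≤m m≤)
                         (proj₁ (not-above t j y 1≤j j≤ by) m j≤m m≤))
        (¬X (proj₂ (not-above t j x 1≤j j≤ bx)) (proj₂ (not-above t j y 1≤j j≤ by))))

      down : Above t j x ⊎ Aside t j x → Above t j y ⊎ Aside t j y → Foot
      down ax ay = down-foot t j J j∈C
        (λ m 1≤m m≤j → ¬X (not-below t j x j≤ ax m 1≤m m≤j) (not-below t j y j≤ ay m 1≤m m≤j))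

      cases : Below t j x ⊎ Above t j x ⊎ Aside t j x → Below t j y ⊎ Above t j y ⊎ Aside t j y →
              PathComponent x y C ⊎ Foot
      cases (inj₁ (k , 1≤k , k<j , x≡k)) (inj₂ (inj₁ (k′ , j<k′ , k′≤ , y≡k′))) =
        inj₁ (pathComponent segment (trans segment-start (sym x≡k)) (trans segment-end (sym y≡k′)) segment-on⇔)
        where open Segment t 1≤k k<j j<k′ k′≤ j∈C (ends-iff x≡k y≡k′)
      cases (inj₂ (inj₁ (k′ , j<k′ , k′≤ , x≡k′))) (inj₁ (k , 1≤k , k<j , y≡k)) =
        inj₁ (pathComponent (reverse R segment)
                (trans segment-end (sym x≡k′))
                (trans (cong (ChordlessSeq.at segment) (n∸n≡0 (k′ ∸ k))) (trans segment-start (sym y≡k)))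
                (λ v → (λ p → onPath-unreverse R segment (proj₁ (segment-on⇔ v) p)) ,
                       (λ o → proj₂ (segment-on⇔ v) (onPath-reverse R segment o))))
        where open Segment t 1≤k k<j j<k′ k′≤ j∈C (ends-iff-swap x≡k′ y≡k)
      cases (inj₁ bx) (inj₁ by) = inj₂ (via-apex (inj₁ bx) (inj₁ by))
      cases (inj₁ bx) (inj₂ (inj₂ sy)) = inj₂ (via-apex (inj₁ bx) (inj₂ sy))
      cases (inj₂ (inj₂ sx)) (inj₁ by) = inj₂ (via-apex (inj₂ sx) (inj₁ by))
      cases (inj₂ ax) (inj₂ ay) = inj₂ (down ax ay)

    foot-or-path : PathComponent x y C ⊎ Foot
    foot-or-path with IsComponent.nonempty IC
    ... | v , v∈C with position v
    ...   | inj₁ refl = inj₂ (foot-from-apex v∈C)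
    ...   | inj₂ (t , j , J , refl) = foot-or-path-from-leg t j J v∈C

  loop-path-impossible : ∀ {u C} → IsComponent R (λ w → w ≡ u) C → ¬ PathComponent u u C
  loop-path-impossible IC (ℓ , Q , _ , s≡u , e≡u , on⇔) with IsComponent.nonempty IC
  ... | v , v∈C with proj₁ (on⇔ v) (inj₁ v∈C)
  ...   | i , e = IsComponent.avoid IC v v∈C (trans (sym e) (trans (cong (vtx Q) i≡0) s≡u))
    where
    ℓ≡0 : ℓ ≡ 0
    ℓ≡0 = sym (trans (cong toℕ (inj Q zero (fromℕ ℓ) (trans s≡u (sym e≡u)))) (toℕ-fromℕ ℓ))
    i≡0 : i ≡ zero
    i≡0 = toℕ-injective (n≤0⇒n≡0 (subst (toℕ i ≤_) ℓ≡0 (toℕ≤pred[n] i)))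

  cut-foot : ∀ u C → IsComponent R (λ w → w ≡ u) C → ∃[ v ] (v ∈ C × deg R v ≡ 1)
  cut-foot u C IC with Component.foot-or-path IC (λ w → inj₁ , [ id , id ]′)
  ... | inj₁ path = ⊥-elim (loop-path-impossible IC path)
  ... | inj₂ foot = foot

  pendant-avoids-apex : ∀ e → Pendant R e → ∀ w → Incident R e w → w ≢ a
  pendant-avoids-apex e p w w∈e with edge-onLeg e
  ... | t , i , I , on with edgeOn-leg-pendant⁻ e I on p
  ...   | refl with incident-edgeOn R e on w∈e
  ...     | inj₁ refl = leg≢apex t 1 I
  ...     | inj₂ refl = leg≢apex t 2 (onLeg-2 t)

  no-branch : ∀ {ℓ} (Q : Path R ℓ) → ¬ IsBranch R Q
  no-branch {ℓ} Q br = <⇒≢ (IsBranch.nontriv br) (sym (begin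
    ℓ                   ≡⟨ toℕ-fromℕ ℓ ⟨
    toℕ (fromℕ ℓ)       ≡⟨ cong toℕ (inj Q _ _ ends-apex) ⟨
    0                   ∎))
    where
    open ≡-Reasoning
    ends-apex = trans (3≤deg⇒apex _ (IsBranch.startDeg br)) (sym (3≤deg⇒apex _ (IsBranch.endDeg br)))

  footEdge : Fin 3 → Edge R
  footEdge t = legEdge t 1 (onLeg-1 t)

  footEdge-pendant : ∀ t → Pendant R (footEdge t)
  footEdge-pendant t = legEdge-foot-pendant t (onLeg-1 t)

  footEdge-injective : ∀ s t → s ≢ t → footEdge s ≢ footEdge t
  footEdge-injective s t s≢t e = legs-disjoint s t 1 1 s≢t (onLeg-1 s) (onLeg-1 t) (legEdge-injective s 1 t 1 _ _ e)

  skeleton : IsSkeleton R 1 lab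
  skeleton = record
    { connected    = connected
    ; triangleFree = triangleFree
    ; chordless    = λ C _ _ _ → ⊥-elim (acyclic C)
    ; threePendant = footEdge zero , footEdge (suc zero) , footEdge (suc (suc zero)) ,
                     footEdge-pendant _ , footEdge-pendant _ , footEdge-pendant _ ,
                     footEdge-injective _ _ (λ ()) , footEdge-injective _ _ (λ ()) , footEdge-injective _ _ (λ ())
    ; noParallel   = λ Q _ brQ _ _ → ⊥-elim (no-branch Q brQ)
    ; cutCond      = λ u _ → cut-foot u
    ; twoCutCond   = λ x y _ C IC → Component.foot-or-path IC (λ w → id , id)
    ; cycleCond    = λ C _ _ _ → ⊥-elim (acyclic C)
    ; kPos         = s≤s z≤n
    ; allUsed      = λ { zero → footEdge zero , footEdge-pendant zero , refl }
    ; someTwice    = zero , footEdge zero , footEdge (suc zero) , footEdge-injective _ _ (λ ()) ,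
                     footEdge-pendant _ , footEdge-pendant _ , refl , refl
    ; uniqueBig    = λ { e p (inj₁ big) → ⊥-elim (pendant-avoids-apex e p _ (inj₁ refl) (3≤deg⇒apex _ big))
                       ; e p (inj₂ big) → ⊥-elim (pendant-avoids-apex e p _ (inj₂ refl) (3≤deg⇒apex _ big)) }
    ; noBranch     = λ _ → refl
    ; parLimbs     = λ { (_ , Q , br) → ⊥-elim (no-branch Q br) }
    ; petalCond    = λ { (s≤s ()) }
    ; kTwo         = λ () }

lemma2p3 : ∀ (n : ℕ) (B : Graph n) → LongPyramid B → IsPGraph B
lemma2p3 n B LP = 1 , n , R , lab , skeleton , φ , toElement-adj
  where open PyramidSkeleton B LP
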